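{- Let $\pi\in\mathbb{Z}[i]$ be a prime lying above a split rational prime $p=\pi\overline{\pi}$, let $\rho\in\mathbb{N}$, and let $A\in\mathbb{Q}(i)^{n\times n}$ be self-adjoint with $v_\pi(A)\ge0$. Let $x=(\xi_1,\dots,\xi_n)^t$, $y=(\upsilon_1,\dots,\upsilon_n)^t\in\mathbb{Z}[i]^n$ with $v_\pi(x)=v_\pi(y)=0$ such that $\pi^\rho\mid \xi_j\upsilon_k-\xi_k\upsilon_j$ for all $1\le j<k\le n$. Then: (a) there is $a\in\mathbb{Z}$ coprime to $p$ with $y\equiv ax \pmod{\pi^\rho}$, and $a$ is well defined modulo $p^\rho$; (b) for such an $a$ there exists $b\in\mathbb{Z}$, unique modulo $p^\rho$, with $b\equiv ai\pmod{\pi^\rho}$, and \[ 2x^*Ay\equiv (a-bi)\,x^*Ax+(a'-b'i)\,y^*Ay \pmod{p^\rho}, \] where $a',b'\in\mathbb{Z}$ are multiplicative inverses of $a,b$ modulo $p^\rho$; (c) $\pi^\rho\mid a'-b'i$ and $\overline{\pi}^\rho\mid a-bi$.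
   Context: For a prime $\pi$ of $\mathbb{Z}[i]$ and $q\in\mathbb{Q}(i)$, $v_\pi(q)$ is the $\pi$-adic valuation; for a vector or matrix it is the minimum over the entries. Vectors are column vectors, $^*$ is conjugate transpose. Congruences are between elements of $\mathbb{Q}(i)$ with nonnegative $\pi$- and $\overline{\pi}$-valuations (taken entrywise for vectors), meaning the difference is divisible by the given modulus in the localized ring. -}

module Defs where

open import Data.Nat using (ℕ; zero; suc) renaming (_*_ to _*ℕ_; _+_ to _+ℕ_)
open import Data.Integer using (ℤ; +_; -_) renaming (_+_ to _+ℤ_; _*_ to _*ℤ_; _-_ to _-ℤ_)
open import Data.Fin using (Fin; zero; suc)
open import Data.Product using (Σ; _×_)
open import Data.Sum using (_⊎_)
open import Relation.Nullary using (¬_)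
open import Relation.Binary.PropositionalEquality using (_≡_)

record GI : Set where
  constructor _+_i
  field
    re : ℤ
    im : ℤ
open GI public

infixl 6 _+ᵍ_ _-ᵍ_
infixl 7 _*ᵍ_

_+ᵍ_ : GI → GI → GI
(a + b i) +ᵍ (c + d i) = (a +ℤ c) + (b +ℤ d) i

-ᵍ_ : GI → GI
-ᵍ (a + b i) = (- a) + (- b) i

_-ᵍ_ : GI → GI → GI
x -ᵍ y = x +ᵍ (-ᵍ y)

_*ᵍ_ : GI → GI → GI
(a + b i) *ᵍ (c + d i) = ((a *ℤ c) -ℤ (b *ℤ d)) + ((a *ℤ d) +ℤ (b *ℤ c)) i

conj : GI → GI
conj (a + b i) = a + (- b) i

ι : ℤ → GI
ι a = a + (+ 0) i

0ᵍ 1ᵍ iᵍ : GI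
0ᵍ = ι (+ 0)
1ᵍ = ι (+ 1)
iᵍ = (+ 0) + (+ 1) i

_^ᵍ_ : GI → ℕ → GI
x ^ᵍ zero = 1ᵍ
x ^ᵍ suc k = x *ᵍ (x ^ᵍ k)

_∣ᵍ_ : GI → GI → Set
β ∣ᵍ α = Σ GI (λ γ → α ≡ β *ᵍ γ)

IsUnitᵍ : GI → Set
IsUnitᵍ α = α ∣ᵍ 1ᵍ

IsPrimeᵍ : GI → Set
IsPrimeᵍ π = ¬ (π ≡ 0ᵍ) × ¬ IsUnitᵍ π
           × (∀ α β → π ∣ᵍ (α *ᵍ β) → (π ∣ᵍ α) ⊎ (π ∣ᵍ β))

Associated : GI → GI → Set
Associated α β = (α ∣ᵍ β) × (β ∣ᵍ α)

-- ℚ(i): fractions α / d with α ∈ ℤ[i], d a positive integer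
-- (every element of ℚ(i) has this form).  The denominator is suc dp.

record ℚi : Set where
  constructor _/suc_
  field
    num : GI
    dp  : ℕ
open ℚi public

den : ℚi → GI
den q = ι (+ suc (dp q))

infixl 6 _+q_ _-q_
infixl 7 _*q_

_+q_ : ℚi → ℚi → ℚi
(α /suc d) +q (β /suc e) =
  ((α *ᵍ ι (+ suc e)) +ᵍ (β *ᵍ ι (+ suc d))) /suc (d +ℕ e +ℕ d *ℕ e)
  -- (suc d)(suc e) = suc (d + e + d e)

_*q_ : ℚi → ℚi → ℚi
(α /suc d) *q (β /suc e) = (α *ᵍ β) /suc (d +ℕ e +ℕ d *ℕ e)

-q_ : ℚi → ℚi
-q (α /suc d) = (-ᵍ α) /suc d

_-q_ : ℚi → ℚi → ℚi
u -q v = u +q (-q v)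

conjq : ℚi → ℚi
conjq (α /suc d) = conj α /suc d

ιq : GI → ℚi
ιq α = α /suc 0

_≃q_ : ℚi → ℚi → Set
u ≃q v = num u *ᵍ den v ≡ num v *ᵍ den u

-- v_π(q) ≥ k, i.e. q ∈ π^k ℤ[i]_(π): q = π^k γ / s with π ∤ s.
vGe : GI → ℕ → ℚi → Set
vGe π k q = Σ GI (λ γ → Σ GI (λ s →
              ¬ (π ∣ᵍ s) × (num q *ᵍ s ≡ (π ^ᵍ k) *ᵍ γ *ᵍ den q)))

-- congruence modulo p^ρ = π^ρ π̄^ρ between elements of ℚ(i):
-- v_π(u - v) ≥ ρ and v_π̄(u - v) ≥ ρ.
CongModPP : GI → ℕ → ℚi → ℚi → Set
CongModPP π ρ u v = vGe π ρ (u -q v) × vGe (conj π) ρ (u -q v)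

sumq : (n : ℕ) → (Fin n → ℚi) → ℚi
sumq zero f = ιq 0ᵍ
sumq (suc n) f = f zero +q sumq n (λ j → f (suc j))

herm : (n : ℕ) → (Fin n → GI) → (Fin n → Fin n → ℚi) → (Fin n → GI) → ℚi
herm n u A w = sumq n (λ j → sumq n (λ k → ιq (conj (u j)) *q A j k *q ιq (w k)))

module Submission where

-- Since p = ππ̄ with π and π̄ not associated, ℤ[i]/π^ρ ≅ ℤ/p^ρ: there is t ∈ ℤ with t ≡ i (mod π^ρ),
-- and α ↦ re α + t·im α reduces ℤ[i] to ℤ modulo π^ρ, an integer divisible by π^ρ being divisible
-- by p^ρ. This gives the integer a with y ≡ ax (x has a coordinate that is a unit mod π) and
-- b = at ≡ ai. A congruence modulo p^ρ in ℚ(i) is one modulo π^ρ and one modulo π̄^ρ in the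
-- localisations, where it follows by substituting these congruences into both sides.

open import Defs

module CommutativeRingˡ where

  open import Algebra.Bundles using (CommutativeRing)
  open import Algebra.Structures using (IsCommutativeRing)
  open import Data.Product using (_,_)
  open import Level using (0ℓ)
  open import Relation.Binary using (IsEquivalence)

  module _ {A : Set} (_≈_ : A → A → Set) (_+_ _*_ : A → A → A) (-_ : A → A) (0# 1# : A)
    (isEquivalence : IsEquivalence _≈_)
    (+-cong : ∀ {x y u v} → x ≈ y → u ≈ v → (x + u) ≈ (y + v))
    (*-cong : ∀ {x y u v} → x ≈ y → u ≈ v → (x * u) ≈ (y * v))
    (-‿cong : ∀ {x y} → x ≈ y → (- x) ≈ (- y))
    (+-assoc : ∀ x y z → ((x + y) + z) ≈ (x + (y + z)))
    (+-comm : ∀ x y → (x + y) ≈ (y + x))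
    (+-identityˡ : ∀ x → (0# + x) ≈ x)
    (-‿inverseˡ : ∀ x → ((- x) + x) ≈ 0#)
    (*-assoc : ∀ x y z → ((x * y) * z) ≈ (x * (y * z)))
    (*-comm : ∀ x y → (x * y) ≈ (y * x))
    (*-identityˡ : ∀ x → (1# * x) ≈ x)
    (distribʳ : ∀ z x y → ((x + y) * z) ≈ ((x * z) + (y * z)))
    where

    open IsEquivalence isEquivalence

    isCommutativeRingˡ : IsCommutativeRing _≈_ _+_ _*_ -_ 0# 1#
    isCommutativeRingˡ = record
      { isRing = record
        { +-isAbelianGroup = record
          { isGroup = record
            { isMonoid = record
              { isSemigroup = record
                { isMagma = record { isEquivalence = isEquivalence ; ∙-cong = +-cong }
                ; assoc = +-assoc }
              ; identity = +-identityˡ , λ x → trans (+-comm x 0#) (+-identityˡ x) }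
            ; inverse = -‿inverseˡ , λ x → trans (+-comm x (- x)) (-‿inverseˡ x)
            ; ⁻¹-cong = -‿cong }
          ; comm = +-comm }
        ; *-cong = *-cong
        ; *-assoc = *-assoc
        ; *-identity = *-identityˡ , λ x → trans (*-comm x 1#) (*-identityˡ x)
        ; distrib = distribˡ , distribʳ }
      ; *-comm = *-comm }
      where
      distribˡ : ∀ z x y → (z * (x + y)) ≈ ((z * x) + (z * y))
      distribˡ z x y =
        trans (*-comm z (x + y)) (trans (distribʳ z x y) (+-cong (*-comm x z) (*-comm y z)))

    commutativeRingˡ : CommutativeRing 0ℓ 0ℓ
    commutativeRingˡ = record { isCommutativeRing = isCommutativeRingˡ }

module GaussianIntegers where

  open CommutativeRingˡ
  open import Algebra.Bundles using (CommutativeRing)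
  import Algebra.Solver.Ring.AlmostCommutativeRing as ACR
  import Algebra.Solver.Ring.Simple as Simple
  open import Data.Nat using (zero; suc; NonZero; _^_) renaming (_+_ to _+ℕ_)
  open import Data.Integer using (ℤ; +_; -_) renaming (_+_ to _+ℤ_; _*_ to _*ℤ_; _-_ to _-ℤ_)
  import Data.Integer as ℤ
  import Data.Integer.Properties as ℤ
  open import Data.Integer.Tactic.RingSolver using (solve-∀)
  open import Relation.Binary.Definitions using (Decidable)
  open import Relation.Binary.PropositionalEquality
  open import Relation.Nullary using (yes; no)

  +ᵍ-assoc : ∀ x y z → (x +ᵍ y) +ᵍ z ≡ x +ᵍ (y +ᵍ z)
  +ᵍ-assoc (a + b i) (c + d i) (e + f i) = cong₂ _+_i (ℤ.+-assoc a c e) (ℤ.+-assoc b d f)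

  +ᵍ-comm : ∀ x y → x +ᵍ y ≡ y +ᵍ x
  +ᵍ-comm (a + b i) (c + d i) = cong₂ _+_i (ℤ.+-comm a c) (ℤ.+-comm b d)

  +ᵍ-identityˡ : ∀ x → 0ᵍ +ᵍ x ≡ x
  +ᵍ-identityˡ (a + b i) = cong₂ _+_i (ℤ.+-identityˡ a) (ℤ.+-identityˡ b)

  -ᵍ‿inverseˡ : ∀ x → (-ᵍ x) +ᵍ x ≡ 0ᵍ
  -ᵍ‿inverseˡ (a + b i) = cong₂ _+_i (ℤ.+-inverseˡ a) (ℤ.+-inverseˡ b)

  *ᵍ-assoc : ∀ x y z → (x *ᵍ y) *ᵍ z ≡ x *ᵍ (y *ᵍ z)
  *ᵍ-assoc (a + b i) (c + d i) (e + f i) = cong₂ _+_i (re-assoc a b c d e f) (im-assoc a b c d e f)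
    where
    re-assoc : ∀ a b c d e f → ((a *ℤ c) -ℤ (b *ℤ d)) *ℤ e -ℤ ((a *ℤ d) +ℤ (b *ℤ c)) *ℤ f
                             ≡ a *ℤ ((c *ℤ e) -ℤ (d *ℤ f)) -ℤ b *ℤ ((c *ℤ f) +ℤ (d *ℤ e))
    re-assoc = solve-∀
    im-assoc : ∀ a b c d e f → ((a *ℤ c) -ℤ (b *ℤ d)) *ℤ f +ℤ ((a *ℤ d) +ℤ (b *ℤ c)) *ℤ e
                             ≡ a *ℤ ((c *ℤ f) +ℤ (d *ℤ e)) +ℤ b *ℤ ((c *ℤ e) -ℤ (d *ℤ f))
    im-assoc = solve-∀

  *ᵍ-comm : ∀ x y → x *ᵍ y ≡ y *ᵍ x
  *ᵍ-comm (a + b i) (c + d i) = cong₂ _+_i (re-comm a b c d) (im-comm a b c d)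
    where
    re-comm : ∀ a b c d → a *ℤ c -ℤ b *ℤ d ≡ c *ℤ a -ℤ d *ℤ b
    re-comm = solve-∀
    im-comm : ∀ a b c d → a *ℤ d +ℤ b *ℤ c ≡ c *ℤ b +ℤ d *ℤ a
    im-comm = solve-∀

  *ᵍ-identityˡ : ∀ x → 1ᵍ *ᵍ x ≡ x
  *ᵍ-identityˡ (a + b i) = cong₂ _+_i (re-identity a b) (im-identity a b)
    where
    re-identity : ∀ a b → + 1 *ℤ a -ℤ + 0 *ℤ b ≡ a
    re-identity = solve-∀
    im-identity : ∀ a b → + 1 *ℤ b +ℤ + 0 *ℤ a ≡ b
    im-identity = solve-∀

  *ᵍ-identityʳ : ∀ x → x *ᵍ 1ᵍ ≡ x
  *ᵍ-identityʳ x = trans (*ᵍ-comm x 1ᵍ) (*ᵍ-identityˡ x)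

  *ᵍ-distribʳ : ∀ z x y → (x +ᵍ y) *ᵍ z ≡ (x *ᵍ z) +ᵍ (y *ᵍ z)
  *ᵍ-distribʳ (e + f i) (a + b i) (c + d i) = cong₂ _+_i (re-distrib a b c d e f) (im-distrib a b c d e f)
    where
    re-distrib : ∀ a b c d e f → (a +ℤ c) *ℤ e -ℤ (b +ℤ d) *ℤ f ≡ (a *ℤ e -ℤ b *ℤ f) +ℤ (c *ℤ e -ℤ d *ℤ f)
    re-distrib = solve-∀
    im-distrib : ∀ a b c d e f → (a +ℤ c) *ℤ f +ℤ (b +ℤ d) *ℤ e ≡ (a *ℤ f +ℤ b *ℤ e) +ℤ (c *ℤ f +ℤ d *ℤ e)
    im-distrib = solve-∀

  ℤ[i] : CommutativeRing _ _
  ℤ[i] = commutativeRingˡ _≡_ _+ᵍ_ _*ᵍ_ (λ x → -ᵍ x) 0ᵍ 1ᵍ isEquivalence (cong₂ _+ᵍ_) (cong₂ _*ᵍ_) (cong (λ x → -ᵍ x))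
    +ᵍ-assoc +ᵍ-comm +ᵍ-identityˡ -ᵍ‿inverseˡ *ᵍ-assoc *ᵍ-comm *ᵍ-identityˡ *ᵍ-distribʳ

  _≟ᵍ_ : Decidable {A = GI} _≡_
  (a + b i) ≟ᵍ (c + d i) with a ℤ.≟ c | b ℤ.≟ d
  ... | yes refl | yes refl = yes refl
  ... | no a≢c   | _        = no λ e → a≢c (cong re e)
  ... | _        | no b≢d   = no λ e → b≢d (cong im e)

  module ℤ[i]-Solver = Simple (ACR.fromCommutativeRing ℤ[i]) _≟ᵍ_

  open ℤ[i]-Solver using (solve; _:*_; _:=_)

  ι-* : ∀ a b → ι (a *ℤ b) ≡ ι a *ᵍ ι b
  ι-* a b = cong₂ _+_i (re-ι a b) (im-ι a b)
    where
    re-ι : ∀ a b → a *ℤ b ≡ a *ℤ b -ℤ + 0 *ℤ + 0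
    re-ι = solve-∀
    im-ι : ∀ a b → + 0 ≡ a *ℤ + 0 +ℤ + 0 *ℤ b
    im-ι = solve-∀

  re+im·i : ∀ x → x ≡ ι (re x) +ᵍ ι (im x) *ᵍ iᵍ
  re+im·i (a + b i) = cong₂ _+_i (re-eq a b) (im-eq a b)
    where
    re-eq : ∀ a b → a ≡ a +ℤ (b *ℤ + 0 -ℤ + 0 *ℤ + 1)
    re-eq = solve-∀
    im-eq : ∀ a b → b ≡ + 0 +ℤ (b *ℤ + 1 +ℤ + 0 *ℤ + 0)
    im-eq = solve-∀

  *ᵍ-cancelʳ-ι : ∀ α β n .{{_ : NonZero n}} → α *ᵍ ι (+ n) ≡ β *ᵍ ι (+ n) → α ≡ β
  *ᵍ-cancelʳ-ι (a + b i) (c + d i) n e =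
    cong₂ _+_i (ℤ.*-cancelʳ-≡ a c (+ n) (trans (sym (re-scale a b)) (trans (cong re e) (re-scale c d))))
               (ℤ.*-cancelʳ-≡ b d (+ n) (trans (sym (im-scale a b)) (trans (cong im e) (im-scale c d))))
    where
    re-scale : ∀ a b → re ((a + b i) *ᵍ ι (+ n)) ≡ a *ℤ + n
    re-scale a b = trans (cong (a *ℤ + n +ℤ_) (cong -_ (ℤ.*-zeroʳ b))) (ℤ.+-identityʳ _)
    im-scale : ∀ a b → im ((a + b i) *ᵍ ι (+ n)) ≡ b *ℤ + n
    im-scale a b = trans (cong (_+ℤ b *ℤ + n) (ℤ.*-zeroʳ a)) (ℤ.+-identityˡ _)

  conj-* : ∀ x y → conj (x *ᵍ y) ≡ conj x *ᵍ conj y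
  conj-* (a + b i) (c + d i) = cong₂ _+_i (re-conj a b c d) (im-conj a b c d)
    where
    re-conj : ∀ a b c d → a *ℤ c -ℤ b *ℤ d ≡ a *ℤ c -ℤ (- b) *ℤ (- d)
    re-conj = solve-∀
    im-conj : ∀ a b c d → - (a *ℤ d +ℤ b *ℤ c) ≡ a *ℤ (- d) +ℤ (- b) *ℤ c
    im-conj = solve-∀

  conj-+ : ∀ x y → conj (x +ᵍ y) ≡ conj x +ᵍ conj y
  conj-+ (a + b i) (c + d i) = cong ((a +ℤ c) +_i) (ℤ.neg-distrib-+ b d)

  conj-sub : ∀ x y → conj (x -ᵍ y) ≡ conj x -ᵍ conj y
  conj-sub x y = conj-+ x (-ᵍ y)

  conj-involutive : ∀ x → conj (conj x) ≡ x
  conj-involutive (a + b i) = cong (a +_i) (ℤ.neg-involutive b)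

  conj-^ : ∀ x k → conj (x ^ᵍ k) ≡ conj x ^ᵍ k
  conj-^ x zero = refl
  conj-^ x (suc k) = trans (conj-* x (x ^ᵍ k)) (cong (conj x *ᵍ_) (conj-^ x k))

  ^ᵍ-+ : ∀ x k l → x ^ᵍ (k +ℕ l) ≡ (x ^ᵍ k) *ᵍ (x ^ᵍ l)
  ^ᵍ-+ x zero l = sym (*ᵍ-identityˡ _)
  ^ᵍ-+ x (suc k) l = trans (cong (x *ᵍ_) (^ᵍ-+ x k l)) (sym (*ᵍ-assoc x _ _))

  ^ᵍ-*-distrib : ∀ x y k → (x *ᵍ y) ^ᵍ k ≡ (x ^ᵍ k) *ᵍ (y ^ᵍ k)
  ^ᵍ-*-distrib x y zero = refl
  ^ᵍ-*-distrib x y (suc k) =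
    trans (cong ((x *ᵍ y) *ᵍ_) (^ᵍ-*-distrib x y k)) (interchange x y (x ^ᵍ k) (y ^ᵍ k))
    where
    interchange : ∀ a b c d → (a *ᵍ b) *ᵍ (c *ᵍ d) ≡ (a *ᵍ c) *ᵍ (b *ᵍ d)
    interchange = solve 4 (λ a b c d → (a :* b) :* (c :* d) := (a :* c) :* (b :* d)) refl

  re-*-conj : ∀ x → re (x *ᵍ conj x) ≡ re x *ℤ re x +ℤ im x *ℤ im x
  re-*-conj (a + b i) = norm a b
    where
    norm : ∀ a b → a *ℤ a -ℤ b *ℤ (- b) ≡ a *ℤ a +ℤ b *ℤ b
    norm = solve-∀

  ι-^ : ∀ m k → ι (+ (m ^ k)) ≡ ι (+ m) ^ᵍ k
  ι-^ m zero = refl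
  ι-^ m (suc k) = trans (cong ι (ℤ.pos-* m (m ^ k))) (trans (ι-* (+ m) _) (cong (ι (+ m) *ᵍ_) (ι-^ m k)))

module GaussianDivisibility where

  open GaussianIntegers
  open ℤ[i]-Solver using (solve; _:+_; _:*_; _:-_; :-_; _:=_; con)
  open import Data.Nat using (suc)
  import Data.Integer as ℤ
  import Data.Integer.Divisibility.Signed as ℤ∣
  open import Data.Product using (_,_)
  open import Data.Sum using (_⊎_; [_,_])
  import Data.Sum as Sum
  open import Function using (_∘_)
  open import Relation.Binary using (IsEquivalence; Setoid)
  open import Relation.Binary.PropositionalEquality hiding ([_])
  open import Relation.Nullary using (¬_)

  infix 4 _∣_

  record _∣_ (m α : GI) : Set where
    constructor divides
    field
      quotient : GI
      equality : α ≡ m *ᵍ quotient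

  ∣⇒∣ᵍ : ∀ {m α} → m ∣ α → m ∣ᵍ α
  ∣⇒∣ᵍ (divides q e) = q , e

  ∣ᵍ⇒∣ : ∀ {m α} → m ∣ᵍ α → m ∣ α
  ∣ᵍ⇒∣ (q , e) = divides q e

  ∣-respʳ : ∀ {m α β} → α ≡ β → m ∣ α → m ∣ β
  ∣-respʳ refl m∣α = m∣α

  ∣-refl : ∀ m → m ∣ m
  ∣-refl m = divides 1ᵍ (sym (*ᵍ-identityʳ m))

  ∣-trans : ∀ {m n α} → m ∣ n → n ∣ α → m ∣ α
  ∣-trans {m} (divides q refl) (divides r refl) = divides (q *ᵍ r) (*ᵍ-assoc m q r)

  1∣ : ∀ α → 1ᵍ ∣ α
  1∣ α = divides α (sym (*ᵍ-identityˡ α))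

  ∣0 : ∀ m → m ∣ 0ᵍ
  ∣0 m = divides 0ᵍ (sym (zeroʳ m))
    where
    zeroʳ : ∀ a → a *ᵍ 0ᵍ ≡ 0ᵍ
    zeroʳ = solve 1 (λ a → a :* con 0ᵍ := con 0ᵍ) refl

  ∣-*ʳ : ∀ {m α} β → m ∣ α → m ∣ α *ᵍ β
  ∣-*ʳ {m} β (divides q refl) = divides (q *ᵍ β) (*ᵍ-assoc m q β)

  ∣-*ˡ : ∀ {m α} β → m ∣ α → m ∣ β *ᵍ α
  ∣-*ˡ {α = α} β m∣α = ∣-respʳ (*ᵍ-comm α β) (∣-*ʳ β m∣α)

  ∣-+ : ∀ {m α β} → m ∣ α → m ∣ β → m ∣ α +ᵍ β
  ∣-+ {m} (divides q refl) (divides r refl) = divides (q +ᵍ r) (distribˡ m q r)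
    where
    distribˡ : ∀ a b c → a *ᵍ b +ᵍ a *ᵍ c ≡ a *ᵍ (b +ᵍ c)
    distribˡ = solve 3 (λ a b c → a :* b :+ a :* c := a :* (b :+ c)) refl

  ∣-neg : ∀ {m α} → m ∣ α → m ∣ -ᵍ α
  ∣-neg {m} (divides q refl) = divides (-ᵍ q) (neg-distribʳ m q)
    where
    neg-distribʳ : ∀ a b → -ᵍ (a *ᵍ b) ≡ a *ᵍ (-ᵍ b)
    neg-distribʳ = solve 2 (λ a b → :- (a :* b) := a :* (:- b)) refl

  ∣-conj : ∀ {m α} → m ∣ α → conj m ∣ conj α
  ∣-conj {m} (divides q refl) = divides (conj q) (conj-* m q)

  ∣conj⇒conj∣ : ∀ {m α} → m ∣ conj α → conj m ∣ α
  ∣conj⇒conj∣ {α = α} m∣ᾱ = ∣-respʳ (conj-involutive α) (∣-conj m∣ᾱ)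

  ∣-conj⁻¹ : ∀ {m α} → conj m ∣ conj α → m ∣ α
  ∣-conj⁻¹ d = subst₂ _∣_ (conj-involutive _) (conj-involutive _) (∣-conj d)

  ∣-^-suc : ∀ x k → x ∣ x ^ᵍ suc k
  ∣-^-suc x k = divides (x ^ᵍ k) refl

  ι-∣ : ∀ {a b} → a ℤ∣.∣ b → ι a ∣ ι b
  ι-∣ {a} (ℤ∣.divides q refl) = divides (ι q) (trans (ι-* q a) (*ᵍ-comm (ι q) (ι a)))

  ∣-re-im : ∀ {n} x → n ℤ∣.∣ re x → n ℤ∣.∣ im x → ι n ∣ x
  ∣-re-im {n} x (ℤ∣.divides u eu) (ℤ∣.divides v ev) = divides (ι u +ᵍ ι v *ᵍ iᵍ) (begin
    x                                         ≡⟨ re+im·i x ⟩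
    ι (re x) +ᵍ ι (im x) *ᵍ iᵍ                ≡⟨ cong₂ (λ a b → ι a +ᵍ ι b *ᵍ iᵍ) eu ev ⟩
    ι (u ℤ.* n) +ᵍ ι (v ℤ.* n) *ᵍ iᵍ          ≡⟨ cong₂ (λ a b → a +ᵍ b *ᵍ iᵍ) (ι-* u n) (ι-* v n) ⟩
    ι u *ᵍ ι n +ᵍ (ι v *ᵍ ι n) *ᵍ iᵍ          ≡⟨ factor (ι u) (ι v) (ι n) ⟩
    ι n *ᵍ (ι u +ᵍ ι v *ᵍ iᵍ)                 ∎)
    where
    open ≡-Reasoning
    factor : ∀ a b c → a *ᵍ c +ᵍ (b *ᵍ c) *ᵍ iᵍ ≡ c *ᵍ (a +ᵍ b *ᵍ iᵍ)
    factor = solve 3 (λ a b c → a :* c :+ (b :* c) :* con iᵍ := c :* (a :+ b :* con iᵍ)) refl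

  infix 4 _≡_[mod_]

  record _≡_[mod_] (α β m : GI) : Set where
    constructor ∣-difference
    field
      divides-difference : m ∣ α -ᵍ β

  open _≡_[mod_] public

  ≡mod⇒∣ᵍ : ∀ {m α β} → α ≡ β [mod m ] → m ∣ᵍ (α -ᵍ β)
  ≡mod⇒∣ᵍ (∣-difference d) = ∣⇒∣ᵍ d

  ∣ᵍ⇒≡mod : ∀ {m α β} → m ∣ᵍ (α -ᵍ β) → α ≡ β [mod m ]
  ∣ᵍ⇒≡mod d = ∣-difference (∣ᵍ⇒∣ d)

  module _ {m : GI} where

    ≡⇒≡mod : ∀ {α β} → α ≡ β → α ≡ β [mod m ]
    ≡⇒≡mod {α} refl = ∣-difference (∣-respʳ (sym (sub-self α)) (∣0 m))
      where
      sub-self : ∀ a → a -ᵍ a ≡ 0ᵍ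
      sub-self = solve 1 (λ a → a :- a := con 0ᵍ) refl

    ≡mod-sym : ∀ {α β} → α ≡ β [mod m ] → β ≡ α [mod m ]
    ≡mod-sym {α} {β} (∣-difference d) = ∣-difference (∣-respʳ (neg-sub α β) (∣-neg d))
      where
      neg-sub : ∀ a b → -ᵍ (a -ᵍ b) ≡ b -ᵍ a
      neg-sub = solve 2 (λ a b → :- (a :- b) := b :- a) refl

    ≡mod-trans : ∀ {α β γ} → α ≡ β [mod m ] → β ≡ γ [mod m ] → α ≡ γ [mod m ]
    ≡mod-trans {α} {β} {γ} (∣-difference d) (∣-difference e) =
      ∣-difference (∣-respʳ (telescope α β γ) (∣-+ d e))
      where
      telescope : ∀ a b c → (a -ᵍ b) +ᵍ (b -ᵍ c) ≡ a -ᵍ c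
      telescope = solve 3 (λ a b c → (a :- b) :+ (b :- c) := a :- c) refl

    ≡mod-isEquivalence : IsEquivalence _≡_[mod m ]
    ≡mod-isEquivalence = record
      { refl = ≡⇒≡mod refl ; sym = ≡mod-sym ; trans = ≡mod-trans }

    ≡mod-setoid : Setoid _ _
    ≡mod-setoid = record { isEquivalence = ≡mod-isEquivalence }

    +-cong-mod : ∀ {α β γ δ} → α ≡ β [mod m ] → γ ≡ δ [mod m ] → α +ᵍ γ ≡ β +ᵍ δ [mod m ]
    +-cong-mod {α} {β} {γ} {δ} (∣-difference d) (∣-difference e) =
      ∣-difference (∣-respʳ (regroup α β γ δ) (∣-+ d e))
      where
      regroup : ∀ a b c d → (a -ᵍ b) +ᵍ (c -ᵍ d) ≡ (a +ᵍ c) -ᵍ (b +ᵍ d)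
      regroup = solve 4 (λ a b c d → (a :- b) :+ (c :- d) := (a :+ c) :- (b :+ d)) refl

    -‿cong-mod : ∀ {α β} → α ≡ β [mod m ] → -ᵍ α ≡ -ᵍ β [mod m ]
    -‿cong-mod {α} {β} (∣-difference d) = ∣-difference (∣-respʳ (neg-sub α β) (∣-neg d))
      where
      neg-sub : ∀ a b → -ᵍ (a -ᵍ b) ≡ (-ᵍ a) -ᵍ (-ᵍ b)
      neg-sub = solve 2 (λ a b → :- (a :- b) := (:- a) :- (:- b)) refl

    *-cong-mod : ∀ {α β γ δ} → α ≡ β [mod m ] → γ ≡ δ [mod m ] → α *ᵍ γ ≡ β *ᵍ δ [mod m ]
    *-cong-mod {α} {β} {γ} {δ} (∣-difference d) (∣-difference e) =
      ∣-difference (∣-respʳ (split α β γ δ) (∣-+ (∣-*ʳ γ d) (∣-*ˡ β e)))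
      where
      split : ∀ a b c d → (a -ᵍ b) *ᵍ c +ᵍ b *ᵍ (c -ᵍ d) ≡ a *ᵍ c -ᵍ b *ᵍ d
      split = solve 4 (λ a b c d → (a :- b) :* c :+ b :* (c :- d) := a :* c :- b :* d) refl

    +-congˡ-mod : ∀ γ {α β} → α ≡ β [mod m ] → γ +ᵍ α ≡ γ +ᵍ β [mod m ]
    +-congˡ-mod γ = +-cong-mod (≡⇒≡mod {γ} refl)

    +-congʳ-mod : ∀ γ {α β} → α ≡ β [mod m ] → α +ᵍ γ ≡ β +ᵍ γ [mod m ]
    +-congʳ-mod γ d = +-cong-mod d (≡⇒≡mod {γ} refl)

    *-congˡ-mod : ∀ γ {α β} → α ≡ β [mod m ] → γ *ᵍ α ≡ γ *ᵍ β [mod m ]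
    *-congˡ-mod γ = *-cong-mod (≡⇒≡mod {γ} refl)

    *-congʳ-mod : ∀ γ {α β} → α ≡ β [mod m ] → α *ᵍ γ ≡ β *ᵍ γ [mod m ]
    *-congʳ-mod γ d = *-cong-mod d (≡⇒≡mod {γ} refl)

    ∣⇒≡0 : ∀ {α} → m ∣ α → α ≡ 0ᵍ [mod m ]
    ∣⇒≡0 {α} d = ∣-difference (∣-respʳ (sub-zero α) d)
      where
      sub-zero : ∀ a → a ≡ a -ᵍ 0ᵍ
      sub-zero = solve 1 (λ a → a := a :- con 0ᵍ) refl

    ≡0⇒∣ : ∀ {α} → α ≡ 0ᵍ [mod m ] → m ∣ α
    ≡0⇒∣ {α} (∣-difference d) = ∣-respʳ (sub-zero α) d
      where
      sub-zero : ∀ a → a -ᵍ 0ᵍ ≡ a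
      sub-zero = solve 1 (λ a → a :- con 0ᵍ := a) refl

  ≡mod⇒≡+ : ∀ {m α β} (d : α ≡ β [mod m ]) → α ≡ β +ᵍ m *ᵍ _∣_.quotient (divides-difference d)
  ≡mod⇒≡+ {m} {α} {β} (∣-difference (divides q e)) = trans (add-sub α β) (cong (β +ᵍ_) e)
    where
    add-sub : ∀ a b → a ≡ b +ᵍ (a -ᵍ b)
    add-sub = solve 2 (λ a b → a := b :+ (a :- b)) refl

  ≡mod-conj : ∀ {m α β} → α ≡ β [mod m ] → conj α ≡ conj β [mod conj m ]
  ≡mod-conj {α = α} {β} (∣-difference d) = ∣-difference (∣-respʳ (conj-sub α β) (∣-conj d))

  ≡mod-∣ : ∀ {m n α β} → m ∣ n → α ≡ β [mod n ] → α ≡ β [mod m ]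
  ≡mod-∣ m∣n (∣-difference d) = ∣-difference (∣-trans m∣n d)

  record IsPrime (ϖ : GI) : Set where
    field
      nonunit : ¬ ϖ ∣ 1ᵍ
      euclid  : ∀ α β → ϖ ∣ α *ᵍ β → ϖ ∣ α ⊎ ϖ ∣ β

    ∤-* : ∀ {α β} → ¬ ϖ ∣ α → ¬ ϖ ∣ β → ¬ ϖ ∣ α *ᵍ β
    ∤-* {α} {β} ϖ∤α ϖ∤β = [ ϖ∤α , ϖ∤β ] ∘ euclid α β

  IsPrimeᵍ⇒IsPrime : ∀ {ϖ} → IsPrimeᵍ ϖ → IsPrime ϖ
  IsPrimeᵍ⇒IsPrime {ϖ} (_ , nonunit , euclid) = record
    { nonunit = nonunit ∘ ∣⇒∣ᵍ
    ; euclid = λ α β d → Sum.map (∣ᵍ⇒∣ {ϖ} {α}) (∣ᵍ⇒∣ {ϖ} {β}) (euclid α β (∣⇒∣ᵍ d)) }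

  IsPrime-conj : ∀ {ϖ} → IsPrime ϖ → IsPrime (conj ϖ)
  IsPrime-conj {ϖ} ϖ-prime = record
    { nonunit = nonunit ∘ ∣-conj⁻¹
    ; euclid = λ α β d →
        Sum.map ∣conj⇒conj∣ ∣conj⇒conj∣
          (euclid (conj α) (conj β) (∣-conj⁻¹ (∣-respʳ (conj-conj-* α β) d))) }
    where
    open IsPrime ϖ-prime
    conj-conj-* : ∀ α β → α *ᵍ β ≡ conj (conj α *ᵍ conj β)
    conj-conj-* α β = sym (trans (conj-* (conj α) (conj β)) (cong₂ _*ᵍ_ (conj-involutive α) (conj-involutive β)))

module GaussianRationals where

  open CommutativeRingˡ
  open GaussianIntegers
  open ℤ[i]-Solver using (solve; _:+_; _:*_; _:-_; :-_; _:=_; con)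
  open import Algebra.Bundles using (CommutativeRing)
  open import Algebra.Structures using (IsCommutativeRing)
  import Algebra.Solver.Ring as RingSolver
  import Algebra.Solver.Ring.AlmostCommutativeRing as ACR
  open import Data.Maybe using (Maybe; just; nothing)
  open import Data.Nat using (suc) renaming (_+_ to _+ℕ_; _*_ to _*ℕ_)
  open import Data.Nat.Tactic.RingSolver using (solve-∀)
  open import Data.Integer using (+_)
  import Data.Integer.Properties as ℤ
  open import Relation.Binary using (IsEquivalence; Setoid)
  import Relation.Binary.Reasoning.Setoid
  open import Relation.Binary.PropositionalEquality
  open import Relation.Nullary using (yes; no)

  0q 1q : ℚi
  0q = ιq 0ᵍ
  1q = ιq 1ᵍ

  den-suc-* : ∀ d e → ι (+ suc (d +ℕ e +ℕ d *ℕ e)) ≡ ι (+ suc d) *ᵍ ι (+ suc e)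
  den-suc-* d e = trans (cong (λ n → ι (+ n)) (suc-* d e)) (trans (cong ι (ℤ.pos-* (suc d) (suc e))) (ι-* (+ suc d) (+ suc e)))
    where
    suc-* : ∀ d e → suc (d +ℕ e +ℕ d *ℕ e) ≡ suc d *ℕ suc e
    suc-* = solve-∀

  den-+q : ∀ q r → den (q +q r) ≡ den q *ᵍ den r
  den-+q (_ /suc d) (_ /suc e) = den-suc-* d e

  den-*q : ∀ q r → den (q *q r) ≡ den q *ᵍ den r
  den-*q (_ /suc d) (_ /suc e) = den-suc-* d e

  ≃q-intro : ∀ q r {a b c d} → num q ≡ a → den q ≡ b → num r ≡ c → den r ≡ d → a *ᵍ d ≡ c *ᵍ b → q ≃q r
  ≃q-intro q r refl refl refl refl e = e

  ≃q-sym : ∀ {q r} → q ≃q r → r ≃q q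
  ≃q-sym = sym

  ≃q-trans : ∀ {q r s} → q ≃q r → r ≃q s → q ≃q s
  ≃q-trans {n₁ /suc k₁} {n₂ /suc k₂} {n₃ /suc k₃} e₁ e₂ =
    *ᵍ-cancelʳ-ι _ _ (suc k₂) (begin
      (n₁ *ᵍ d₃) *ᵍ d₂ ≡⟨ swap n₁ d₃ d₂ ⟩
      (n₁ *ᵍ d₂) *ᵍ d₃ ≡⟨ cong (_*ᵍ d₃) e₁ ⟩
      (n₂ *ᵍ d₁) *ᵍ d₃ ≡⟨ swap n₂ d₁ d₃ ⟩
      (n₂ *ᵍ d₃) *ᵍ d₁ ≡⟨ cong (_*ᵍ d₁) e₂ ⟩
      (n₃ *ᵍ d₂) *ᵍ d₁ ≡⟨ swap n₃ d₂ d₁ ⟩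
      (n₃ *ᵍ d₁) *ᵍ d₂ ∎)
    where
    open ≡-Reasoning
    d₁ d₂ d₃ : GI
    d₁ = ι (+ suc k₁)
    d₂ = ι (+ suc k₂)
    d₃ = ι (+ suc k₃)
    swap : ∀ x y z → (x *ᵍ y) *ᵍ z ≡ (x *ᵍ z) *ᵍ y
    swap = solve 3 (λ x y z → (x :* y) :* z := (x :* z) :* y) refl

  ≃q-isEquivalence : IsEquivalence _≃q_
  ≃q-isEquivalence = record
    { refl = refl ; sym = λ {q} {r} → ≃q-sym {q} {r} ; trans = λ {q} {r} {s} → ≃q-trans {q} {r} {s} }

  ≃q-setoid : Setoid _ _
  ≃q-setoid = record { isEquivalence = ≃q-isEquivalence }

  module ≃q-Reasoning = Relation.Binary.Reasoning.Setoid ≃q-setoid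

  +q-assoc : ∀ q r s → ((q +q r) +q s) ≃q (q +q (r +q s))
  +q-assoc q r s = ≃q-intro ((q +q r) +q s) (q +q (r +q s))
    (cong (λ X → (num q *ᵍ den r +ᵍ num r *ᵍ den q) *ᵍ den s +ᵍ num s *ᵍ X) (den-+q q r))
    (trans (den-+q (q +q r) s) (cong (_*ᵍ den s) (den-+q q r)))
    (cong (λ X → num q *ᵍ X +ᵍ (num r *ᵍ den s +ᵍ num s *ᵍ den r) *ᵍ den q) (den-+q r s))
    (trans (den-+q q (r +q s)) (cong (den q *ᵍ_) (den-+q r s)))
    (cross (num q) (den q) (num r) (den r) (num s) (den s))
    where
    cross : ∀ n₁ d₁ n₂ d₂ n₃ d₃ → ((n₁ *ᵍ d₂ +ᵍ n₂ *ᵍ d₁) *ᵍ d₃ +ᵍ n₃ *ᵍ (d₁ *ᵍ d₂)) *ᵍ (d₁ *ᵍ (d₂ *ᵍ d₃))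
                               ≡ (n₁ *ᵍ (d₂ *ᵍ d₃) +ᵍ (n₂ *ᵍ d₃ +ᵍ n₃ *ᵍ d₂) *ᵍ d₁) *ᵍ ((d₁ *ᵍ d₂) *ᵍ d₃)
    cross = solve 6 (λ n₁ d₁ n₂ d₂ n₃ d₃ →
      ((n₁ :* d₂ :+ n₂ :* d₁) :* d₃ :+ n₃ :* (d₁ :* d₂)) :* (d₁ :* (d₂ :* d₃))
      := (n₁ :* (d₂ :* d₃) :+ (n₂ :* d₃ :+ n₃ :* d₂) :* d₁) :* ((d₁ :* d₂) :* d₃)) refl

  +q-comm : ∀ q r → (q +q r) ≃q (r +q q)
  +q-comm q r = ≃q-intro (q +q r) (r +q q) refl (den-+q q r) refl (den-+q r q)
    (cross (num q) (den q) (num r) (den r))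
    where
    cross : ∀ n₁ d₁ n₂ d₂ → (n₁ *ᵍ d₂ +ᵍ n₂ *ᵍ d₁) *ᵍ (d₂ *ᵍ d₁) ≡ (n₂ *ᵍ d₁ +ᵍ n₁ *ᵍ d₂) *ᵍ (d₁ *ᵍ d₂)
    cross = solve 4 (λ n₁ d₁ n₂ d₂ →
      (n₁ :* d₂ :+ n₂ :* d₁) :* (d₂ :* d₁) := (n₂ :* d₁ :+ n₁ :* d₂) :* (d₁ :* d₂)) refl

  +q-identityˡ : ∀ q → (0q +q q) ≃q q
  +q-identityˡ q = ≃q-intro (0q +q q) q refl (den-+q 0q q) refl refl (cross (num q) (den q))
    where
    cross : ∀ n d → (0ᵍ *ᵍ d +ᵍ n *ᵍ 1ᵍ) *ᵍ d ≡ n *ᵍ (1ᵍ *ᵍ d)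
    cross = solve 2 (λ n d → (con 0ᵍ :* d :+ n :* con 1ᵍ) :* d := n :* (con 1ᵍ :* d)) refl

  -q‿inverseˡ : ∀ q → ((-q q) +q q) ≃q 0q
  -q‿inverseˡ q = ≃q-intro ((-q q) +q q) 0q refl (den-+q (-q q) q) refl refl (cross (num q) (den q))
    where
    cross : ∀ n d → ((-ᵍ n) *ᵍ d +ᵍ n *ᵍ d) *ᵍ 1ᵍ ≡ 0ᵍ *ᵍ (d *ᵍ d)
    cross = solve 2 (λ n d → ((:- n) :* d :+ n :* d) :* con 1ᵍ := con 0ᵍ :* (d :* d)) refl

  *q-assoc : ∀ q r s → ((q *q r) *q s) ≃q (q *q (r *q s))
  *q-assoc q r s = ≃q-intro ((q *q r) *q s) (q *q (r *q s)) refl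
    (trans (den-*q (q *q r) s) (cong (_*ᵍ den s) (den-*q q r)))
    refl
    (trans (den-*q q (r *q s)) (cong (den q *ᵍ_) (den-*q r s)))
    (cross (num q) (den q) (num r) (den r) (num s) (den s))
    where
    cross : ∀ n₁ d₁ n₂ d₂ n₃ d₃ → ((n₁ *ᵍ n₂) *ᵍ n₃) *ᵍ (d₁ *ᵍ (d₂ *ᵍ d₃))
                               ≡ (n₁ *ᵍ (n₂ *ᵍ n₃)) *ᵍ ((d₁ *ᵍ d₂) *ᵍ d₃)
    cross = solve 6 (λ n₁ d₁ n₂ d₂ n₃ d₃ →
      ((n₁ :* n₂) :* n₃) :* (d₁ :* (d₂ :* d₃)) := (n₁ :* (n₂ :* n₃)) :* ((d₁ :* d₂) :* d₃)) refl

  *q-comm : ∀ q r → (q *q r) ≃q (r *q q)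
  *q-comm q r = ≃q-intro (q *q r) (r *q q) refl (den-*q q r) refl (den-*q r q)
    (cross (num q) (den q) (num r) (den r))
    where
    cross : ∀ n₁ d₁ n₂ d₂ → (n₁ *ᵍ n₂) *ᵍ (d₂ *ᵍ d₁) ≡ (n₂ *ᵍ n₁) *ᵍ (d₁ *ᵍ d₂)
    cross = solve 4 (λ n₁ d₁ n₂ d₂ → (n₁ :* n₂) :* (d₂ :* d₁) := (n₂ :* n₁) :* (d₁ :* d₂)) refl

  *q-identityˡ : ∀ q → (1q *q q) ≃q q
  *q-identityˡ q = ≃q-intro (1q *q q) q refl (den-*q 1q q) refl refl (cross (num q) (den q))
    where
    cross : ∀ n d → (1ᵍ *ᵍ n) *ᵍ d ≡ n *ᵍ (1ᵍ *ᵍ d)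
    cross = solve 2 (λ n d → (con 1ᵍ :* n) :* d := n :* (con 1ᵍ :* d)) refl

  *q-distribʳ : ∀ s q r → ((q +q r) *q s) ≃q ((q *q s) +q (r *q s))
  *q-distribʳ s q r = ≃q-intro ((q +q r) *q s) ((q *q s) +q (r *q s)) refl
    (trans (den-*q (q +q r) s) (cong (_*ᵍ den s) (den-+q q r)))
    (cong₂ (λ X Y → (num q *ᵍ num s) *ᵍ X +ᵍ (num r *ᵍ num s) *ᵍ Y) (den-*q r s) (den-*q q s))
    (trans (den-+q (q *q s) (r *q s)) (cong₂ _*ᵍ_ (den-*q q s) (den-*q r s)))
    (cross (num q) (den q) (num r) (den r) (num s) (den s))
    where
    cross : ∀ n₁ d₁ n₂ d₂ n₃ d₃ → ((n₁ *ᵍ d₂ +ᵍ n₂ *ᵍ d₁) *ᵍ n₃) *ᵍ ((d₁ *ᵍ d₃) *ᵍ (d₂ *ᵍ d₃))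
                               ≡ ((n₁ *ᵍ n₃) *ᵍ (d₂ *ᵍ d₃) +ᵍ (n₂ *ᵍ n₃) *ᵍ (d₁ *ᵍ d₃)) *ᵍ ((d₁ *ᵍ d₂) *ᵍ d₃)
    cross = solve 6 (λ n₁ d₁ n₂ d₂ n₃ d₃ →
      ((n₁ :* d₂ :+ n₂ :* d₁) :* n₃) :* ((d₁ :* d₃) :* (d₂ :* d₃))
      := ((n₁ :* n₃) :* (d₂ :* d₃) :+ (n₂ :* n₃) :* (d₁ :* d₃)) :* ((d₁ :* d₂) :* d₃)) refl

  +q-cong : ∀ q q′ r r′ → q ≃q q′ → r ≃q r′ → (q +q r) ≃q (q′ +q r′)
  +q-cong q q′ r r′ e₁ e₂ = ≃q-intro (q +q r) (q′ +q r′) refl (den-+q q r) refl (den-+q q′ r′)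
    (begin
      (n₁ *ᵍ d₂ +ᵍ n₂ *ᵍ d₁) *ᵍ (d₁′ *ᵍ d₂′)                    ≡⟨ expand n₁ d₁ n₂ d₂ d₁′ d₂′ ⟩
      (n₁ *ᵍ d₁′) *ᵍ (d₂ *ᵍ d₂′) +ᵍ (n₂ *ᵍ d₂′) *ᵍ (d₁ *ᵍ d₁′)  ≡⟨ cong₂ (λ X Y → X *ᵍ (d₂ *ᵍ d₂′) +ᵍ Y *ᵍ (d₁ *ᵍ d₁′)) e₁ e₂ ⟩
      (n₁′ *ᵍ d₁) *ᵍ (d₂ *ᵍ d₂′) +ᵍ (n₂′ *ᵍ d₂) *ᵍ (d₁ *ᵍ d₁′)  ≡⟨ collect n₁′ d₁ n₂′ d₂ d₁′ d₂′ ⟩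
      (n₁′ *ᵍ d₂′ +ᵍ n₂′ *ᵍ d₁′) *ᵍ (d₁ *ᵍ d₂)                  ∎)
    where
    open ≡-Reasoning
    n₁ d₁ n₂ d₂ n₁′ d₁′ n₂′ d₂′ : GI
    n₁ = num q
    d₁ = den q
    n₂ = num r
    d₂ = den r
    n₁′ = num q′
    d₁′ = den q′
    n₂′ = num r′
    d₂′ = den r′
    expand : ∀ a b c d e f → (a *ᵍ d +ᵍ c *ᵍ b) *ᵍ (e *ᵍ f) ≡ (a *ᵍ e) *ᵍ (d *ᵍ f) +ᵍ (c *ᵍ f) *ᵍ (b *ᵍ e)
    expand = solve 6 (λ a b c d e f →
      (a :* d :+ c :* b) :* (e :* f) := (a :* e) :* (d :* f) :+ (c :* f) :* (b :* e)) refl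
    collect : ∀ a b c d e f → (a *ᵍ b) *ᵍ (d *ᵍ f) +ᵍ (c *ᵍ d) *ᵍ (b *ᵍ e) ≡ (a *ᵍ f +ᵍ c *ᵍ e) *ᵍ (b *ᵍ d)
    collect = solve 6 (λ a b c d e f →
      (a :* b) :* (d :* f) :+ (c :* d) :* (b :* e) := (a :* f :+ c :* e) :* (b :* d)) refl

  *q-cong : ∀ q q′ r r′ → q ≃q q′ → r ≃q r′ → (q *q r) ≃q (q′ *q r′)
  *q-cong q q′ r r′ e₁ e₂ = ≃q-intro (q *q r) (q′ *q r′) refl (den-*q q r) refl (den-*q q′ r′)
    (begin
      (num q *ᵍ num r) *ᵍ (den q′ *ᵍ den r′)   ≡⟨ interchange (num q) (num r) (den q′) (den r′) ⟩
      (num q *ᵍ den q′) *ᵍ (num r *ᵍ den r′)   ≡⟨ cong₂ _*ᵍ_ e₁ e₂ ⟩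
      (num q′ *ᵍ den q) *ᵍ (num r′ *ᵍ den r)   ≡⟨ interchange (num q′) (den q) (num r′) (den r) ⟩
      (num q′ *ᵍ num r′) *ᵍ (den q *ᵍ den r)   ∎)
    where
    open ≡-Reasoning
    interchange : ∀ a b c d → (a *ᵍ b) *ᵍ (c *ᵍ d) ≡ (a *ᵍ c) *ᵍ (b *ᵍ d)
    interchange = solve 4 (λ a b c d → (a :* b) :* (c :* d) := (a :* c) :* (b :* d)) refl

  -q‿cong : ∀ q q′ → q ≃q q′ → (-q q) ≃q (-q q′)
  -q‿cong q q′ e = trans (neg-distribˡ (num q) (den q′)) (trans (cong (λ x → -ᵍ x) e) (sym (neg-distribˡ (num q′) (den q))))
    where
    neg-distribˡ : ∀ a b → (-ᵍ a) *ᵍ b ≡ -ᵍ (a *ᵍ b)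
    neg-distribˡ = solve 2 (λ a b → (:- a) :* b := :- (a :* b)) refl

  ιq-+ : ∀ α β → ιq (α +ᵍ β) ≃q (ιq α +q ιq β)
  ιq-+ = cross
    where
    cross : ∀ a b → (a +ᵍ b) *ᵍ 1ᵍ ≡ (a *ᵍ 1ᵍ +ᵍ b *ᵍ 1ᵍ) *ᵍ 1ᵍ
    cross = solve 2 (λ a b → (a :+ b) :* con 1ᵍ := (a :* con 1ᵍ :+ b :* con 1ᵍ) :* con 1ᵍ) refl

  -- The solver below works over opaque copies of the operations: with the
  -- transparent ones, comparing normal forms would unfold the fractions.
  infixl 6 _⊕_
  infixl 7 _⊗_

  opaque
    _⊕_ _⊗_ : ℚi → ℚi → ℚi
    _⊕_ = _+q_
    _⊗_ = _*q_

    ⊝_ : ℚi → ℚi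
    ⊝_ = -q_

  opaque
    unfolding _⊕_ _⊗_ ⊝_

    ℚ[i]-isCommutativeRing : IsCommutativeRing _≃q_ _⊕_ _⊗_ ⊝_ 0q 1q
    ℚ[i]-isCommutativeRing = isCommutativeRingˡ _≃q_ _⊕_ _⊗_ ⊝_ 0q 1q ≃q-isEquivalence
      (λ {q} {q′} {r} {r′} → +q-cong q q′ r r′) (λ {q} {q′} {r} {r′} → *q-cong q q′ r r′)
      (λ {q} {q′} → -q‿cong q q′) +q-assoc +q-comm +q-identityˡ -q‿inverseˡ *q-assoc *q-comm *q-identityˡ *q-distribʳ

    ιq-⊕ : ∀ α β → ιq (α +ᵍ β) ≃q (ιq α ⊕ ιq β)
    ιq-⊕ = ιq-+

    ιq-⊗ : ∀ α β → ιq (α *ᵍ β) ≃q (ιq α ⊗ ιq β)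
    ιq-⊗ α β = refl

    ιq-⊝ : ∀ α → ιq (-ᵍ α) ≃q (⊝ ιq α)
    ιq-⊝ α = refl

  ℚ[i] : CommutativeRing _ _
  ℚ[i] = record { isCommutativeRing = ℚ[i]-isCommutativeRing }

  ιq-homomorphism : CommutativeRing.rawRing ℤ[i] ACR.-Raw-AlmostCommutative⟶ ACR.fromCommutativeRing ℚ[i]
  ιq-homomorphism = record
    { ⟦_⟧ = ιq ; +-homo = ιq-⊕ ; *-homo = ιq-⊗ ; -‿homo = ιq-⊝ ; 0-homo = refl ; 1-homo = refl }

  ιq-≟ : (α β : GI) → Maybe (ιq α ≃q ιq β)
  ιq-≟ α β with α ≟ᵍ β
  ... | yes refl = just refl
  ... | no _ = nothing

  module ℚ[i]-Solver = RingSolver (CommutativeRing.rawRing ℤ[i]) (ACR.fromCommutativeRing ℚ[i]) ιq-homomorphism ιq-≟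

module Valuation where

  open GaussianIntegers
  open ℤ[i]-Solver using (solve; _:+_; _:*_; :-_; _:=_)
  open GaussianDivisibility
  open GaussianRationals
  open import Data.Fin using (Fin; zero; suc)
  open import Data.Nat using (ℕ; zero; suc) renaming (_+_ to _+ℕ_)
  open import Data.Integer using (+_)
  open import Data.Product using (_,_)
  open import Relation.Binary.PropositionalEquality
  open import Relation.Nullary using (¬_)

  record Val≥ (ϖ : GI) (k : ℕ) (q : ℚi) : Set where
    constructor val≥
    field
      γ s : GI
      ϖ∤s : ¬ ϖ ∣ s
      equation : num q *ᵍ s ≡ (ϖ ^ᵍ k) *ᵍ γ *ᵍ den q

  Integral : GI → ℚi → Set
  Integral ϖ = Val≥ ϖ 0

  Val≥⇒vGe : ∀ {ϖ k q} → Val≥ ϖ k q → vGe ϖ k q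
  Val≥⇒vGe (val≥ γ s ϖ∤s e) = γ , s , (λ d → ϖ∤s (∣ᵍ⇒∣ d)) , e

  vGe⇒Val≥ : ∀ {ϖ k q} → vGe ϖ k q → Val≥ ϖ k q
  vGe⇒Val≥ (γ , s , ϖ∤s , e) = val≥ γ s (λ d → ϖ∤s (∣⇒∣ᵍ d)) e

  Val≥-conj : ∀ {ϖ k q} → Val≥ ϖ k q → Val≥ (conj ϖ) k (conjq q)
  Val≥-conj {ϖ} {k} {α /suc d} (val≥ γ s ϖ∤s e) = val≥ (conj γ) (conj s) (λ d → ϖ∤s (∣-conj⁻¹ d)) (begin
    conj α *ᵍ conj s               ≡⟨ conj-* α s ⟨
    conj (α *ᵍ s)                  ≡⟨ cong conj e ⟩
    conj (ϖ ^ᵍ k *ᵍ γ *ᵍ D)        ≡⟨ conj-* (ϖ ^ᵍ k *ᵍ γ) D ⟩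
    conj (ϖ ^ᵍ k *ᵍ γ) *ᵍ D        ≡⟨ cong (_*ᵍ D) (conj-* (ϖ ^ᵍ k) γ) ⟩
    conj (ϖ ^ᵍ k) *ᵍ conj γ *ᵍ D   ≡⟨ cong (λ X → X *ᵍ conj γ *ᵍ D) (conj-^ ϖ k) ⟩
    conj ϖ ^ᵍ k *ᵍ conj γ *ᵍ D     ∎)
    where
    open ≡-Reasoning
    D : GI
    D = ι (+ suc d)

  module _ {ϖ : GI} (ϖ-prime : IsPrime ϖ) where

    open IsPrime ϖ-prime

    Val≥-resp : ∀ {k} q r → q ≃q r → Val≥ ϖ k q → Val≥ ϖ k r
    Val≥-resp {k} q r q≃r (val≥ γ s ϖ∤s e) = val≥ γ s ϖ∤s (*ᵍ-cancelʳ-ι _ _ (suc (dp q)) (begin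
      (num r *ᵍ s) *ᵍ den q           ≡⟨ swap (num r) s (den q) ⟩
      (num r *ᵍ den q) *ᵍ s           ≡⟨ cong (_*ᵍ s) q≃r ⟨
      (num q *ᵍ den r) *ᵍ s           ≡⟨ swap (num q) (den r) s ⟩
      (num q *ᵍ s) *ᵍ den r           ≡⟨ cong (_*ᵍ den r) e ⟩
      (ϖ^k *ᵍ γ *ᵍ den q) *ᵍ den r    ≡⟨ swap (ϖ^k *ᵍ γ) (den q) (den r) ⟩
      (ϖ^k *ᵍ γ *ᵍ den r) *ᵍ den q    ∎))
      where
      open ≡-Reasoning
      ϖ^k : GI
      ϖ^k = ϖ ^ᵍ k
      swap : ∀ a b c → (a *ᵍ b) *ᵍ c ≡ (a *ᵍ c) *ᵍ b
      swap = solve 3 (λ a b c → (a :* b) :* c := (a :* c) :* b) refl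

    Val≥-+ : ∀ {k} q r → Val≥ ϖ k q → Val≥ ϖ k r → Val≥ ϖ k (q +q r)
    Val≥-+ {k} q r (val≥ γ₁ s₁ ϖ∤s₁ e₁) (val≥ γ₂ s₂ ϖ∤s₂ e₂) =
      val≥ (γ₁ *ᵍ s₂ +ᵍ γ₂ *ᵍ s₁) (s₁ *ᵍ s₂) (∤-* ϖ∤s₁ ϖ∤s₂) (begin
        (num q *ᵍ den r +ᵍ num r *ᵍ den q) *ᵍ (s₁ *ᵍ s₂)
          ≡⟨ expand (num q) (den r) (num r) (den q) s₁ s₂ ⟩
        (num q *ᵍ s₁) *ᵍ (den r *ᵍ s₂) +ᵍ (num r *ᵍ s₂) *ᵍ (den q *ᵍ s₁)
          ≡⟨ cong₂ (λ X Y → X *ᵍ (den r *ᵍ s₂) +ᵍ Y *ᵍ (den q *ᵍ s₁)) e₁ e₂ ⟩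
        (ϖ^k *ᵍ γ₁ *ᵍ den q) *ᵍ (den r *ᵍ s₂) +ᵍ (ϖ^k *ᵍ γ₂ *ᵍ den r) *ᵍ (den q *ᵍ s₁)
          ≡⟨ collect ϖ^k γ₁ γ₂ s₁ s₂ (den q) (den r) ⟩
        ϖ^k *ᵍ (γ₁ *ᵍ s₂ +ᵍ γ₂ *ᵍ s₁) *ᵍ (den q *ᵍ den r)
          ≡⟨ cong (ϖ^k *ᵍ (γ₁ *ᵍ s₂ +ᵍ γ₂ *ᵍ s₁) *ᵍ_) (den-+q q r) ⟨
        ϖ^k *ᵍ (γ₁ *ᵍ s₂ +ᵍ γ₂ *ᵍ s₁) *ᵍ den (q +q r) ∎)
      where
      open ≡-Reasoning
      ϖ^k : GI
      ϖ^k = ϖ ^ᵍ k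
      expand : ∀ a b c d e f → (a *ᵍ b +ᵍ c *ᵍ d) *ᵍ (e *ᵍ f) ≡ (a *ᵍ e) *ᵍ (b *ᵍ f) +ᵍ (c *ᵍ f) *ᵍ (d *ᵍ e)
      expand = solve 6 (λ a b c d e f →
        (a :* b :+ c :* d) :* (e :* f) := (a :* e) :* (b :* f) :+ (c :* f) :* (d :* e)) refl
      collect : ∀ P a b e f D E → (P *ᵍ a *ᵍ D) *ᵍ (E *ᵍ f) +ᵍ (P *ᵍ b *ᵍ E) *ᵍ (D *ᵍ e)
                                ≡ P *ᵍ (a *ᵍ f +ᵍ b *ᵍ e) *ᵍ (D *ᵍ E)
      collect = solve 7 (λ P a b e f D E →
        (P :* a :* D) :* (E :* f) :+ (P :* b :* E) :* (D :* e) := P :* (a :* f :+ b :* e) :* (D :* E)) refl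

    Val≥-* : ∀ {k l} q r → Val≥ ϖ k q → Val≥ ϖ l r → Val≥ ϖ (k +ℕ l) (q *q r)
    Val≥-* {k} {l} q r (val≥ γ₁ s₁ ϖ∤s₁ e₁) (val≥ γ₂ s₂ ϖ∤s₂ e₂) =
      val≥ (γ₁ *ᵍ γ₂) (s₁ *ᵍ s₂) (∤-* ϖ∤s₁ ϖ∤s₂) (begin
        (num q *ᵍ num r) *ᵍ (s₁ *ᵍ s₂)                       ≡⟨ interchange (num q) (num r) s₁ s₂ ⟩
        (num q *ᵍ s₁) *ᵍ (num r *ᵍ s₂)                       ≡⟨ cong₂ _*ᵍ_ e₁ e₂ ⟩
        (ϖ ^ᵍ k *ᵍ γ₁ *ᵍ den q) *ᵍ (ϖ ^ᵍ l *ᵍ γ₂ *ᵍ den r)  ≡⟨ regroup (ϖ ^ᵍ k) (ϖ ^ᵍ l) γ₁ γ₂ (den q) (den r) ⟩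
        (ϖ ^ᵍ k *ᵍ ϖ ^ᵍ l) *ᵍ (γ₁ *ᵍ γ₂) *ᵍ (den q *ᵍ den r)
          ≡⟨ cong₂ (λ X Y → X *ᵍ (γ₁ *ᵍ γ₂) *ᵍ Y) (^ᵍ-+ ϖ k l) (den-*q q r) ⟨
        ϖ ^ᵍ (k +ℕ l) *ᵍ (γ₁ *ᵍ γ₂) *ᵍ den (q *q r)          ∎)
      where
      open ≡-Reasoning
      interchange : ∀ a b c d → (a *ᵍ b) *ᵍ (c *ᵍ d) ≡ (a *ᵍ c) *ᵍ (b *ᵍ d)
      interchange = solve 4 (λ a b c d → (a :* b) :* (c :* d) := (a :* c) :* (b :* d)) refl
      regroup : ∀ P Q a b D E → (P *ᵍ a *ᵍ D) *ᵍ (Q *ᵍ b *ᵍ E) ≡ (P *ᵍ Q) *ᵍ (a *ᵍ b) *ᵍ (D *ᵍ E)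
      regroup = solve 6 (λ P Q a b D E →
        (P :* a :* D) :* (Q :* b :* E) := (P :* Q) :* (a :* b) :* (D :* E)) refl

    Val≥-ιq : ∀ {k α} → ϖ ^ᵍ k ∣ α → Val≥ ϖ k (ιq α)
    Val≥-ιq (divides γ refl) = val≥ γ 1ᵍ nonunit refl

    Val≥-neg : ∀ {k} q → Val≥ ϖ k q → Val≥ ϖ k (-q q)
    Val≥-neg {k} q (val≥ γ s ϖ∤s e) =
      val≥ (-ᵍ γ) s ϖ∤s (trans (neg-distribˡ (num q) s) (trans (cong (λ x → -ᵍ x) e) (neg-inside (ϖ ^ᵍ k) γ (den q))))
      where
      neg-distribˡ : ∀ a b → (-ᵍ a) *ᵍ b ≡ -ᵍ (a *ᵍ b)
      neg-distribˡ = solve 2 (λ a b → (:- a) :* b := :- (a :* b)) refl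
      neg-inside : ∀ a b c → -ᵍ (a *ᵍ b *ᵍ c) ≡ a *ᵍ (-ᵍ b) *ᵍ c
      neg-inside = solve 3 (λ a b c → :- (a :* b :* c) := a :* (:- b) :* c) refl

    Val≥-sumq : ∀ {k} n (f : Fin n → ℚi) → (∀ j → Val≥ ϖ k (f j)) → Val≥ ϖ k (sumq n f)
    Val≥-sumq zero f _ = Val≥-ιq (∣0 _)
    Val≥-sumq (suc n) f v = Val≥-+ (f zero) _ (v zero) (Val≥-sumq n (λ j → f (suc j)) (λ j → v (suc j)))

    Integral-ιq : ∀ α → Integral ϖ (ιq α)
    Integral-ιq α = Val≥-ιq (1∣ α)

    Integral-herm : ∀ n u (A : Fin n → Fin n → ℚi) w → (∀ j k → Integral ϖ (A j k)) → Integral ϖ (herm n u A w)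
    Integral-herm n u A w A-integral =
      Val≥-sumq n _ λ j → Val≥-sumq n _ λ k →
        Val≥-* (ιq (conj (u j)) *q A j k) (ιq (w k))
          (Val≥-* (ιq (conj (u j))) (A j k) (Integral-ιq (conj (u j))) (A-integral j k))
          (Integral-ιq (w k))

  Integral-selfadjoint-conj : ∀ {ϖ} → IsPrime (conj ϖ) → ∀ {n} (A : Fin n → Fin n → ℚi)
                            → (∀ j k → A k j ≃q conjq (A j k)) → (∀ j k → Integral ϖ (A j k))
                            → ∀ j k → Integral (conj ϖ) (A j k)
  Integral-selfadjoint-conj ϖ̄-prime A A-selfadjoint A-integral j k =
    Val≥-resp ϖ̄-prime (conjq (A k j)) (A j k) (sym (A-selfadjoint k j)) (Val≥-conj (A-integral k j))

module LocalCongruence where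

  open GaussianIntegers
  open ℤ[i]-Solver using (solve; _:+_; _:*_; _:-_; :-_; _:=_; con)
  open GaussianDivisibility
  open GaussianRationals
  open Valuation
  open import Data.Fin using (Fin; zero; suc)
  open import Data.Nat using (ℕ; zero; suc)
  open import Data.Nat.Properties using (+-identityʳ)
  open import Relation.Binary using (Setoid)
  open import Relation.Binary.PropositionalEquality

  private
    module ℚ = ℚ[i]-Solver

    ⊕-sub-self : ∀ q → (q ⊕ ⊝ q) ≃q 0q
    ⊕-sub-self = ℚ.solve 1 (λ q → q ℚ.:- q ℚ.:= ℚ.con 0ᵍ) refl

    ⊕-telescope : ∀ q r s → (q ⊕ ⊝ s) ≃q ((q ⊕ ⊝ r) ⊕ (r ⊕ ⊝ s))
    ⊕-telescope = ℚ.solve 3 (λ q r s → q ℚ.:- s ℚ.:= (q ℚ.:- r) ℚ.:+ (r ℚ.:- s)) refl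

    ⊕-neg-sub : ∀ q r → (⊝ (q ⊕ ⊝ r)) ≃q (r ⊕ ⊝ q)
    ⊕-neg-sub = ℚ.solve 2 (λ q r → ℚ.:- (q ℚ.:- r) ℚ.:= r ℚ.:- q) refl

    ⊕-regroup : ∀ q r q′ r′ → ((q ⊕ r) ⊕ ⊝ (q′ ⊕ r′)) ≃q ((q ⊕ ⊝ q′) ⊕ (r ⊕ ⊝ r′))
    ⊕-regroup = ℚ.solve 4 (λ q r q′ r′ →
      (q ℚ.:+ r) ℚ.:- (q′ ℚ.:+ r′) ℚ.:= (q ℚ.:- q′) ℚ.:+ (r ℚ.:- r′)) refl

    ⊗-split : ∀ q r q′ r′ → ((q ⊗ r) ⊕ ⊝ (q′ ⊗ r′)) ≃q (r ⊗ (q ⊕ ⊝ q′) ⊕ q′ ⊗ (r ⊕ ⊝ r′))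
    ⊗-split = ℚ.solve 4 (λ q r q′ r′ →
      (q ℚ.:* r) ℚ.:- (q′ ℚ.:* r′) ℚ.:= r ℚ.:* (q ℚ.:- q′) ℚ.:+ q′ ℚ.:* (r ℚ.:- r′)) refl

    ⊕-identityʳ : ∀ q → (q ⊕ 0q) ≃q q
    ⊕-identityʳ = ℚ.solve 1 (λ q → q ℚ.:+ ℚ.con 0ᵍ ℚ.:= q) refl

    ⊕-sub-zero : ∀ q → (q ⊕ ⊝ 0q) ≃q q
    ⊕-sub-zero = ℚ.solve 1 (λ q → q ℚ.:- ℚ.con 0ᵍ ℚ.:= q) refl

    ⊗-linear-zero : ∀ c d → 0q ≃q ((c ⊗ 0q) ⊕ (d ⊗ 0q))
    ⊗-linear-zero = ℚ.solve 2 (λ c d → ℚ.con 0ᵍ ℚ.:= (c ℚ.:* ℚ.con 0ᵍ) ℚ.:+ (d ℚ.:* ℚ.con 0ᵍ)) refl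

    ⊗-linear-+ : ∀ c d f g f′ g′ → (((c ⊗ f) ⊕ (d ⊗ g)) ⊕ ((c ⊗ f′) ⊕ (d ⊗ g′))) ≃q ((c ⊗ (f ⊕ f′)) ⊕ (d ⊗ (g ⊕ g′)))
    ⊗-linear-+ = ℚ.solve 6 (λ c d f g f′ g′ →
      ((c ℚ.:* f) ℚ.:+ (d ℚ.:* g)) ℚ.:+ ((c ℚ.:* f′) ℚ.:+ (d ℚ.:* g′))
      ℚ.:= (c ℚ.:* (f ℚ.:+ f′)) ℚ.:+ (d ℚ.:* (g ℚ.:+ g′))) refl

    ⊗-linearʳ : ∀ X a b v z → (X ⊗ ((a ⊗ v) ⊕ (b ⊗ z))) ≃q ((a ⊗ (X ⊗ v)) ⊕ (b ⊗ (X ⊗ z)))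
    ⊗-linearʳ = ℚ.solve 5 (λ X a b v z →
      X ℚ.:* ((a ℚ.:* v) ℚ.:+ (b ℚ.:* z)) ℚ.:= (a ℚ.:* (X ℚ.:* v)) ℚ.:+ (b ℚ.:* (X ℚ.:* z))) refl

    ⊗-linearˡ : ∀ Y W a b v z → ((((a ⊗ v) ⊕ (b ⊗ z)) ⊗ Y) ⊗ W) ≃q ((a ⊗ ((v ⊗ Y) ⊗ W)) ⊕ (b ⊗ ((z ⊗ Y) ⊗ W)))
    ⊗-linearˡ = ℚ.solve 6 (λ Y W a b v z →
      (((a ℚ.:* v) ℚ.:+ (b ℚ.:* z)) ℚ.:* Y) ℚ.:* W
      ℚ.:= (a ℚ.:* ((v ℚ.:* Y) ℚ.:* W)) ℚ.:+ (b ℚ.:* ((z ℚ.:* Y) ℚ.:* W))) refl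

  opaque
    unfolding _⊕_ _⊗_ ⊝_

    -q-self : ∀ q → (q -q q) ≃q 0q
    -q-self = ⊕-sub-self

    -q-telescope : ∀ q r s → (q -q s) ≃q ((q -q r) +q (r -q s))
    -q-telescope = ⊕-telescope

    -q‿-q : ∀ q r → (-q (q -q r)) ≃q (r -q q)
    -q‿-q = ⊕-neg-sub

    +q-q-regroup : ∀ q r q′ r′ → ((q +q r) -q (q′ +q r′)) ≃q ((q -q q′) +q (r -q r′))
    +q-q-regroup = ⊕-regroup

    *q-q-split : ∀ q r q′ r′ → ((q *q r) -q (q′ *q r′)) ≃q (r *q (q -q q′) +q q′ *q (r -q r′))
    *q-q-split = ⊗-split

    +q-identityʳ : ∀ q → (q +q 0q) ≃q q
    +q-identityʳ = ⊕-identityʳ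

    -q-zero : ∀ q → (q -q 0q) ≃q q
    -q-zero = ⊕-sub-zero

    *q-linear-zero : ∀ c d → 0q ≃q ((c *q 0q) +q (d *q 0q))
    *q-linear-zero = ⊗-linear-zero

    *q-linear-+ : ∀ c d f g f′ g′ → (((c *q f) +q (d *q g)) +q ((c *q f′) +q (d *q g′))) ≃q ((c *q (f +q f′)) +q (d *q (g +q g′)))
    *q-linear-+ = ⊗-linear-+

    *q-linearʳ : ∀ X a b v z → (X *q ((a *q v) +q (b *q z))) ≃q ((a *q (X *q v)) +q (b *q (X *q z)))
    *q-linearʳ = ⊗-linearʳ

    *q-linearˡ : ∀ Y W a b v z → ((((a *q v) +q (b *q z)) *q Y) *q W) ≃q ((a *q ((v *q Y) *q W)) +q (b *q ((z *q Y) *q W)))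
    *q-linearˡ = ⊗-linearˡ

  ιq-sub : ∀ α β → (ιq α -q ιq β) ≃q (ιq (α -ᵍ β))
  ιq-sub = cross
    where
    cross : ∀ a b → (a *ᵍ 1ᵍ +ᵍ (-ᵍ b) *ᵍ 1ᵍ) *ᵍ 1ᵍ ≡ (a -ᵍ b) *ᵍ 1ᵍ
    cross = solve 2 (λ a b → (a :* con 1ᵍ :+ (:- b) :* con 1ᵍ) :* con 1ᵍ := (a :- b) :* con 1ᵍ) refl

  sumq-linear : ∀ n c d (f g h : Fin n → ℚi) → (∀ j → h j ≃q ((c *q f j) +q (d *q g j)))
              → sumq n h ≃q ((c *q sumq n f) +q (d *q sumq n g))
  sumq-linear zero c d f g h _ = *q-linear-zero c d
  sumq-linear (suc n) c d f g h h≃ = begin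
    h zero +q sumq n h′                                         ≈⟨ +q-cong (h zero) (c *q f zero +q d *q g zero)
                                                                     (sumq n h′) (c *q Σf +q d *q Σg) (h≃ zero)
                                                                     (sumq-linear n c d f′ g′ h′ (λ j → h≃ (suc j))) ⟩
    (c *q f zero +q d *q g zero) +q (c *q Σf +q d *q Σg)        ≈⟨ *q-linear-+ c d (f zero) (g zero) Σf Σg ⟩
    c *q (f zero +q Σf) +q d *q (g zero +q Σg)                  ∎
    where
    open ≃q-Reasoning
    f′ g′ h′ : Fin n → ℚi
    f′ j = f (suc j)
    g′ j = g (suc j)
    h′ j = h (suc j)
    Σf Σg : ℚi
    Σf = sumq n f′
    Σg = sumq n g′

  module _ (n : ℕ) (A : Fin n → Fin n → ℚi) where

    herm-linearʳ : ∀ u w α β v z → (∀ k → w k ≡ (α *ᵍ v k) +ᵍ (β *ᵍ z k))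
                 → herm n u A w ≃q ((ιq α *q herm n u A v) +q (ιq β *q herm n u A z))
    herm-linearʳ u w α β v z w≡ =
      sumq-linear n (ιq α) (ιq β) _ _ _ λ j →
        sumq-linear n (ιq α) (ιq β) _ _ _ λ k → begin
          X j k *q ιq (w k)                                       ≡⟨ cong (λ w → X j k *q ιq w) (w≡ k) ⟩
          X j k *q ιq (α *ᵍ v k +ᵍ β *ᵍ z k)                       ≈⟨ *q-cong (X j k) (X j k) (ιq (α *ᵍ v k +ᵍ β *ᵍ z k)) (ιq α *q ιq (v k) +q ιq β *q ιq (z k))
                                                                        refl (ιq-+ (α *ᵍ v k) (β *ᵍ z k)) ⟩
          X j k *q (ιq α *q ιq (v k) +q ιq β *q ιq (z k))         ≈⟨ *q-linearʳ (X j k) (ιq α) (ιq β) (ιq (v k)) (ιq (z k)) ⟩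
          ιq α *q (X j k *q ιq (v k)) +q ιq β *q (X j k *q ιq (z k)) ∎
      where
      open ≃q-Reasoning
      X : Fin n → Fin n → ℚi
      X j k = ιq (conj (u j)) *q A j k

    herm-linearˡ : ∀ u w α β v z → (∀ j → conj (u j) ≡ (α *ᵍ conj (v j)) +ᵍ (β *ᵍ conj (z j)))
                 → herm n u A w ≃q ((ιq α *q herm n v A w) +q (ιq β *q herm n z A w))
    herm-linearˡ u w α β v z ū≡ =
      sumq-linear n (ιq α) (ιq β) _ _ _ λ j →
        sumq-linear n (ιq α) (ιq β) _ _ _ λ k → begin
          ιq (conj (u j)) *q A j k *q ιq (w k)                    ≡⟨ cong (λ u → ιq u *q A j k *q ιq (w k)) (ū≡ j) ⟩
          ιq (α *ᵍ v̄ j +ᵍ β *ᵍ z̄ j) *q A j k *q ιq (w k)         ≈⟨ *q-cong (ιq (α *ᵍ v̄ j +ᵍ β *ᵍ z̄ j) *q A j k) (ū′ j *q A j k) (ιq (w k)) (ιq (w k))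
                                                                       (*q-cong (ιq (α *ᵍ v̄ j +ᵍ β *ᵍ z̄ j)) (ū′ j) (A j k) (A j k) (ιq-+ (α *ᵍ v̄ j) (β *ᵍ z̄ j)) refl)
                                                                       refl ⟩
          ū′ j *q A j k *q ιq (w k)                               ≈⟨ *q-linearˡ (A j k) (ιq (w k)) (ιq α) (ιq β) (ιq (v̄ j)) (ιq (z̄ j)) ⟩
          ιq α *q (ιq (v̄ j) *q A j k *q ιq (w k)) +q ιq β *q (ιq (z̄ j) *q A j k *q ιq (w k)) ∎
      where
      open ≃q-Reasoning
      v̄ z̄ : Fin n → GI
      v̄ j = conj (v j)
      z̄ j = conj (z j)
      ū′ : Fin n → ℚi
      ū′ j = ιq α *q ιq (v̄ j) +q ιq β *q ιq (z̄ j)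

  infix 4 _≡q_[mod_^_]

  record _≡q_[mod_^_] (q r : ℚi) (ϖ : GI) (k : ℕ) : Set where
    constructor ≡q-intro
    field
      Val≥-difference : Val≥ ϖ k (q -q r)

  open _≡q_[mod_^_] public

  module _ {ϖ : GI} (ϖ-prime : IsPrime ϖ) {k : ℕ} where

    private
      Val≥-resp′ : ∀ q r → q ≃q r → Val≥ ϖ k q → Val≥ ϖ k r
      Val≥-resp′ = Val≥-resp ϖ-prime

    Val≥⇒≡q0 : ∀ {q} → Val≥ ϖ k q → q ≡q 0q [mod ϖ ^ k ]
    Val≥⇒≡q0 {q} v = ≡q-intro (Val≥-resp′ q (q -q 0q) (≃q-sym {q -q 0q} {q} (-q-zero q)) v)

    ≃q⇒≡q : ∀ {q r} → q ≃q r → q ≡q r [mod ϖ ^ k ]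
    ≃q⇒≡q {q} {r} q≃r = ≡q-intro (Val≥-resp′ 0q (q -q r) 0≃q-r (Val≥-ιq ϖ-prime (∣0 _)))
      where
      open ≃q-Reasoning
      0≃q-r : 0q ≃q (q -q r)
      0≃q-r = begin
        0q      ≈⟨ -q-self q ⟨
        q -q q  ≈⟨ +q-cong q q (-q q) (-q r) refl (-q‿cong q r q≃r) ⟩
        q -q r  ∎

    ≡q-sym : ∀ {q r} → q ≡q r [mod ϖ ^ k ] → r ≡q q [mod ϖ ^ k ]
    ≡q-sym {q} {r} (≡q-intro v) =
      ≡q-intro (Val≥-resp′ (-q (q -q r)) (r -q q) (-q‿-q q r) (Val≥-neg ϖ-prime (q -q r) v))

    ≡q-trans : ∀ {q r s} → q ≡q r [mod ϖ ^ k ] → r ≡q s [mod ϖ ^ k ] → q ≡q s [mod ϖ ^ k ]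
    ≡q-trans {q} {r} {s} (≡q-intro v) (≡q-intro w) =
      ≡q-intro (Val≥-resp′ ((q -q r) +q (r -q s)) (q -q s)
        (≃q-sym {q -q s} {(q -q r) +q (r -q s)} (-q-telescope q r s))
        (Val≥-+ ϖ-prime (q -q r) (r -q s) v w))

    ≡q-setoid : Setoid _ _
    ≡q-setoid = record
      { Carrier = ℚi
      ; _≈_ = λ q r → q ≡q r [mod ϖ ^ k ]
      ; isEquivalence = record { refl = ≃q⇒≡q refl ; sym = ≡q-sym ; trans = ≡q-trans } }

    +q-cong-mod : ∀ q q′ r r′ → q ≡q q′ [mod ϖ ^ k ] → r ≡q r′ [mod ϖ ^ k ] → q +q r ≡q q′ +q r′ [mod ϖ ^ k ]
    +q-cong-mod q q′ r r′ (≡q-intro v) (≡q-intro w) =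
      ≡q-intro (Val≥-resp′ ((q -q q′) +q (r -q r′)) ((q +q r) -q (q′ +q r′))
        (≃q-sym {(q +q r) -q (q′ +q r′)} {(q -q q′) +q (r -q r′)} (+q-q-regroup q r q′ r′))
        (Val≥-+ ϖ-prime (q -q q′) (r -q r′) v w))

    *q-cong-mod : ∀ q q′ r r′ → Integral ϖ r → Integral ϖ q′
                → q ≡q q′ [mod ϖ ^ k ] → r ≡q r′ [mod ϖ ^ k ] → q *q r ≡q q′ *q r′ [mod ϖ ^ k ]
    *q-cong-mod q q′ r r′ r-integral q′-integral (≡q-intro v) (≡q-intro w) =
      ≡q-intro (Val≥-resp′ (r *q (q -q q′) +q q′ *q (r -q r′)) ((q *q r) -q (q′ *q r′))
        (≃q-sym {(q *q r) -q (q′ *q r′)} {r *q (q -q q′) +q q′ *q (r -q r′)} (*q-q-split q r q′ r′))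
        (Val≥-+ ϖ-prime (r *q (q -q q′)) (q′ *q (r -q r′))
          (Val≥-* ϖ-prime r (q -q q′) r-integral v) (Val≥-* ϖ-prime q′ (r -q r′) q′-integral w)))

    ιq-cong-mod : ∀ {α β} → α ≡ β [mod ϖ ^ᵍ k ] → ιq α ≡q ιq β [mod ϖ ^ k ]
    ιq-cong-mod {α} {β} (∣-difference d) =
      ≡q-intro (Val≥-resp′ (ιq (α -ᵍ β)) (ιq α -q ιq β) (≃q-sym {ιq α -q ιq β} {ιq (α -ᵍ β)} (ιq-sub α β))
        (Val≥-ιq ϖ-prime d))

    ≃+multiple⇒≡q : ∀ q r h → q ≃q (r +q ιq (ϖ ^ᵍ k) *q h) → Integral ϖ h → q ≡q r [mod ϖ ^ k ]
    ≃+multiple⇒≡q q r h q≃ h-integral = begin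
      q                         ≈⟨ ≃q⇒≡q q≃ ⟩
      r +q ιq (ϖ ^ᵍ k) *q h     ≈⟨ +q-cong-mod r r (ιq (ϖ ^ᵍ k) *q h) 0q (≃q⇒≡q refl) (Val≥⇒≡q0 multiple) ⟩
      r +q 0q                   ≈⟨ ≃q⇒≡q (+q-identityʳ r) ⟩
      r                         ∎
      where
      open import Relation.Binary.Reasoning.Setoid ≡q-setoid
      multiple : Val≥ ϖ k (ιq (ϖ ^ᵍ k) *q h)
      multiple = subst (λ l → Val≥ ϖ l (ιq (ϖ ^ᵍ k) *q h)) (+-identityʳ k)
        (Val≥-* ϖ-prime (ιq (ϖ ^ᵍ k)) h (Val≥-ιq ϖ-prime (∣-refl _)) h-integral)

    module _ (n : ℕ) (A : Fin n → Fin n → ℚi) (A-integral : ∀ j k → Integral ϖ (A j k)) where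

      herm-congʳ : ∀ u w c v → (∀ j → w j ≡ c *ᵍ v j [mod ϖ ^ᵍ k ])
                 → herm n u A w ≡q ιq c *q herm n u A v [mod ϖ ^ k ]
      herm-congʳ u w c v w≡cv =
        ≃+multiple⇒≡q (herm n u A w) (ιq c *q herm n u A v) (herm n u A e)
          (herm-linearʳ n A u w c (ϖ ^ᵍ k) v e (λ j → ≡mod⇒≡+ (w≡cv j)))
          (Integral-herm ϖ-prime n u A e A-integral)
        where
        e : Fin n → GI
        e j = _∣_.quotient (divides-difference (w≡cv j))

      herm-congˡ : ∀ u w c v → (∀ j → conj (u j) ≡ c *ᵍ conj (v j) [mod ϖ ^ᵍ k ])
                 → herm n u A w ≡q ιq c *q herm n v A w [mod ϖ ^ k ]
      herm-congˡ u w c v ū≡cv̄ =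
        ≃+multiple⇒≡q (herm n u A w) (ιq c *q herm n v A w) (herm n ē A w)
          (herm-linearˡ n A u w c (ϖ ^ᵍ k) v ē ū≡)
          (Integral-herm ϖ-prime n ē A w A-integral)
        where
        ē : Fin n → GI
        ē j = conj (_∣_.quotient (divides-difference (ū≡cv̄ j)))
        ū≡ : ∀ j → conj (u j) ≡ c *ᵍ conj (v j) +ᵍ ϖ ^ᵍ k *ᵍ conj (ē j)
        ū≡ j = trans (≡mod⇒≡+ (ū≡cv̄ j)) (cong (λ e → c *ᵍ conj (v j) +ᵍ ϖ ^ᵍ k *ᵍ e) (sym (conj-involutive _)))

module IntegerModular where

  open import Data.Nat as ℕ using (ℕ; zero; suc)
  import Data.Nat.Divisibility as ℕ
  open import Data.Nat.Coprimality as Coprimality using (Coprime; coprime-Bézout; coprime-factors; 1-coprimeTo)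
  open import Data.Nat.GCD using (module Bézout)
  open import Data.Nat.Primality using (Prime; euclidsLemma; prime⇒irreducible)
  open import Data.Integer using (ℤ; +_; -[1+_]; -_; _+_; _*_; _-_; ∣_∣)
  import Data.Integer.Properties as ℤ
  open import Data.Integer.Divisibility.Signed
  open import Data.Integer.Tactic.RingSolver using (solve-∀)
  open import Data.Product using (Σ; _,_)
  open import Data.Sum using (_⊎_; inj₁; inj₂)
  import Data.Sum as Sum
  open import Relation.Binary.PropositionalEquality
  open import Relation.Nullary using (¬_; contradiction)

  prime-∣-* : ∀ {p} → Prime p → ∀ a b → + p ∣ a * b → (+ p ∣ a) ⊎ (+ p ∣ b)
  prime-∣-* p-prime a b p∣ab =
    Sum.map ∣ᵤ⇒∣ ∣ᵤ⇒∣ (euclidsLemma ∣ a ∣ ∣ b ∣ p-prime (subst (ℕ._∣_ _) (ℤ.abs-* a b) (∣⇒∣ᵤ p∣ab)))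

  prime-∤⇒coprime : ∀ {p} → Prime p → ∀ c → ¬ (+ p ∣ c) → Coprime ∣ c ∣ p
  prime-∤⇒coprime p-prime c p∤c (d∣c , d∣p) with prime⇒irreducible p-prime d∣p
  ... | inj₁ d≡1 = d≡1
  ... | inj₂ refl = contradiction (∣ᵤ⇒∣ d∣c) p∤c

  coprime-* : ∀ {m n o} → Coprime m n → Coprime m o → Coprime m (n ℕ.* o)
  coprime-* {m} {n} {o} m⊥n m⊥o (d∣m , d∣no) =
    m⊥o (d∣m , coprime-factors m⊥n (ℕ.∣-trans d∣m (ℕ.m∣m*n o) , d∣no))

  coprime-^ : ∀ {m p} → Coprime m p → ∀ k → Coprime m (p ℕ.^ k)
  coprime-^ {m} m⊥p zero = Coprimality.sym (1-coprimeTo m)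
  coprime-^ m⊥p (suc k) = coprime-* m⊥p (coprime-^ m⊥p k)

  inverse-mod : ∀ c P → Coprime ∣ c ∣ P → Σ ℤ λ c′ → + P ∣ c * c′ - + 1
  inverse-mod (+ m) P m⊥P = inverse-mod-ℕ (coprime-Bézout m⊥P)
    where
    inverse-mod-ℕ : Bézout.Identity 1 m P → Σ ℤ λ m′ → + P ∣ + m * m′ - + 1
    inverse-mod-ℕ (Bézout.+- x y eq) = + x , divides (+ y) (begin
      + m * + x - + 1        ≡⟨ cong (_- + 1) (ℤ.*-comm (+ m) (+ x)) ⟩
      + x * + m - + 1        ≡⟨ cong (λ n → n - + 1) (ℤ.pos-* x m) ⟨
      + (x ℕ.* m) - + 1      ≡⟨ cong (λ n → + n - + 1) eq ⟨
      + (1 ℕ.+ y ℕ.* P) - + 1 ≡⟨ cong (λ n → + 1 + n - + 1) (ℤ.pos-* y P) ⟩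
      + 1 + + y * + P - + 1  ≡⟨ cancel (+ y * + P) ⟩
      + y * + P              ∎)
      where
      open ≡-Reasoning
      cancel : ∀ a → + 1 + a - + 1 ≡ a
      cancel = solve-∀
    inverse-mod-ℕ (Bézout.-+ x y eq) = - + x , divides (- + y) (begin
      + m * - + x - + 1       ≡⟨ negate (+ m) (+ x) ⟩
      - (+ 1 + + x * + m)     ≡⟨ cong (λ n → - (+ 1 + n)) (ℤ.pos-* x m) ⟨
      - + (1 ℕ.+ x ℕ.* m)     ≡⟨ cong (λ n → - + n) eq ⟩
      - + (y ℕ.* P)           ≡⟨ cong -_ (ℤ.pos-* y P) ⟩
      - (+ y * + P)           ≡⟨ ℤ.neg-distribˡ-* (+ y) (+ P) ⟩
      - + y * + P             ∎)
      where
      open ≡-Reasoning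
      negate : ∀ a b → a * - b - + 1 ≡ - (+ 1 + b * a)
      negate = solve-∀
  inverse-mod -[1+ n ] P n⊥P with c′ , divides q eq ← inverse-mod (+ suc n) P n⊥P =
    - c′ , divides q (trans (neg-*-neg (+ suc n) c′) eq)
    where
    neg-*-neg : ∀ a b → - a * - b - + 1 ≡ a * b - + 1
    neg-*-neg = solve-∀

module SplitPrime where

  open GaussianIntegers
  open ℤ[i]-Solver using (solve; _:+_; _:*_; _:-_; :-_; _:=_; con)
  open GaussianDivisibility
  open IntegerModular
  open import Data.Nat as ℕ using (ℕ; zero; suc; _^_)
  open import Data.Nat.Coprimality as Coprimality using (Coprime; 1-coprimeTo)
  open import Data.Nat.Primality using (Prime; prime⇒nonZero)
  open import Data.Integer using (ℤ; +_; -_; ∣_∣) renaming (_+_ to _+ℤ_; _*_ to _*ℤ_; _-_ to _-ℤ_)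
  import Data.Integer.Properties as ℤ
  open import Data.Integer.Divisibility.Signed as ℤ∣ using () renaming (_∣_ to _∣ℤ_)
  open import Data.Integer.Tactic.RingSolver using (solve-∀)
  open import Data.Product using (Σ; _,_; proj₁; proj₂)
  import Data.Sum as Sum
  open import Relation.Binary.PropositionalEquality
  open import Relation.Nullary using (¬_)

  -- Reduction ℤ[i] → ℤ sending i to t; a ring homomorphism modulo any P dividing t² + 1.
  reduce : ℤ → GI → ℤ
  reduce t α = re α +ℤ im α *ℤ t

  ≡ι-reduce : ∀ {m t} → ι t ≡ iᵍ [mod m ] → ∀ α → α ≡ ι (reduce t α) [mod m ]
  ≡ι-reduce {m} {t} t≡i α = begin
    α                                ≈⟨ ≡⇒≡mod (re+im·i α) ⟩
    ι (re α) +ᵍ ι (im α) *ᵍ iᵍ       ≈⟨ +-congˡ-mod (ι (re α)) (*-congˡ-mod (ι (im α)) (≡mod-sym t≡i)) ⟩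
    ι (re α) +ᵍ ι (im α) *ᵍ ι t      ≡⟨ cong (ι (re α) +ᵍ_) (ι-* (im α) t) ⟨
    ι (reduce t α)                   ∎
    where open import Relation.Binary.Reasoning.Setoid (≡mod-setoid {m})

  p∣N∧p∣im⇒p∣re : ∀ {p} → Prime p → ∀ x → + p ∣ℤ re x *ℤ re x +ℤ im x *ℤ im x → + p ∣ℤ im x → + p ∣ℤ re x
  p∣N∧p∣im⇒p∣re {p} p-prime x p∣N p∣V = Sum.reduce (prime-∣-* p-prime (re x) (re x) p∣U²)
    where
    cancel : ∀ U V → U *ℤ U +ℤ V *ℤ V -ℤ V *ℤ V ≡ U *ℤ U
    cancel = solve-∀
    p∣U² : + p ∣ℤ re x *ℤ re x
    p∣U² = subst (+ p ∣ℤ_) (cancel (re x) (im x)) (ℤ∣.∣m∣n⇒∣m-n p∣N (ℤ∣.∣m⇒∣m*n (im x) p∣V))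

  record RootOfMinusOne (x : GI) (P : ℤ) : Set where
    field
      t : ℤ
      t≡i : ι t ≡ iᵍ [mod x ]
      P∣t²+1 : P ∣ℤ t *ℤ t +ℤ + 1
      P∣x↦t : P ∣ℤ reduce t x

  rootOfMinusOne : ∀ x {P W} → re x *ℤ re x +ℤ im x *ℤ im x ≡ P → P ∣ℤ im x *ℤ W -ℤ + 1
                 → (∀ {n} → P ∣ℤ n → x ∣ ι n) → RootOfMinusOne x P
  rootOfMinusOne x {P} {W} N[x]≡P P∣VW-1 P∣⇒x∣ = record { t = t ; t≡i = t≡i ; P∣t²+1 = P∣t²+1 ; P∣x↦t = P∣x↦t }
    where
    U V : ℤ
    U = re x
    V = im x
    t = - (U *ℤ W)
    t≡i : ι t ≡ iᵍ [mod x ]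
    t≡i = ∣-difference (∣-respʳ (sym t-i≡) (∣-+ (∣-*ˡ (-ᵍ ι W) x∣x) (∣-*ʳ iᵍ (P∣⇒x∣ P∣VW-1))))
      where
      x∣x : x ∣ ι U +ᵍ ι V *ᵍ iᵍ
      x∣x = ∣-respʳ (re+im·i x) (∣-refl x)
      split : ∀ u v w I → (-ᵍ (u *ᵍ w)) -ᵍ I ≡ (-ᵍ w) *ᵍ (u +ᵍ v *ᵍ I) +ᵍ (v *ᵍ w -ᵍ 1ᵍ) *ᵍ I
      split = solve 4 (λ u v w I → (:- (u :* w)) :- I := (:- w) :* (u :+ v :* I) :+ (v :* w :- con 1ᵍ) :* I) refl
      t-i≡ : ι t -ᵍ iᵍ ≡ (-ᵍ ι W) *ᵍ (ι U +ᵍ ι V *ᵍ iᵍ) +ᵍ (ι (V *ℤ W) -ᵍ 1ᵍ) *ᵍ iᵍ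
      t-i≡ = trans (cong (λ z → (-ᵍ z) -ᵍ iᵍ) (ι-* U W))
                   (trans (split (ι U) (ι V) (ι W) iᵍ) (cong (λ z → (-ᵍ ι W) *ᵍ (ι U +ᵍ ι V *ᵍ iᵍ) +ᵍ (z -ᵍ 1ᵍ) *ᵍ iᵍ) (sym (ι-* V W))))
    P∣t²+1 : P ∣ℤ t *ℤ t +ℤ + 1
    P∣t²+1 = subst (P ∣ℤ_) (trans (cong (λ N → W *ℤ W *ℤ N -ℤ (V *ℤ W -ℤ + 1) *ℤ (V *ℤ W +ℤ + 1)) (sym N[x]≡P)) (expand U V W))
               (ℤ∣.∣m∣n⇒∣m-n (ℤ∣.∣n⇒∣m*n (W *ℤ W) ℤ∣.∣-refl) (ℤ∣.∣m⇒∣m*n (V *ℤ W +ℤ + 1) P∣VW-1))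
      where
      expand : ∀ U V W → W *ℤ W *ℤ (U *ℤ U +ℤ V *ℤ V) -ℤ (V *ℤ W -ℤ + 1) *ℤ (V *ℤ W +ℤ + 1)
                       ≡ (- (U *ℤ W)) *ℤ (- (U *ℤ W)) +ℤ + 1
      expand = solve-∀
    P∣x↦t : P ∣ℤ reduce t x
    P∣x↦t = subst (P ∣ℤ_) (factor U V W) (ℤ∣.∣n⇒∣m*n (- U) P∣VW-1)
      where
      factor : ∀ U V W → (- U) *ℤ (V *ℤ W -ℤ + 1) ≡ U +ℤ V *ℤ (- (U *ℤ W))
      factor = solve-∀

  ∣ι⇒∣ : ∀ {x P n} → RootOfMinusOne x P → x ∣ ι n → P ∣ℤ n
  ∣ι⇒∣ {x} {P} {n} root (divides γ xγ≡n) =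
    subst (P ∣ℤ_) (sym n≡) (ℤ∣.∣m∣n⇒∣m-n (ℤ∣.∣m∣n⇒∣m-n (ℤ∣.∣m⇒∣m*n (reduce t γ) P∣x↦t) (ℤ∣.∣n⇒∣m*n (im x *ℤ im γ) P∣t²+1))
                                    (ℤ∣.∣n⇒∣m*n t (subst (P ∣ℤ_) (cong im xγ≡n) (ℤ∣.divides (+ 0) refl))))
    where
    open RootOfMinusOne root
    expand : ∀ U V g₁ g₂ t → U *ℤ g₁ -ℤ V *ℤ g₂
           ≡ (U +ℤ V *ℤ t) *ℤ (g₁ +ℤ g₂ *ℤ t) -ℤ (V *ℤ g₂) *ℤ (t *ℤ t +ℤ + 1) -ℤ t *ℤ (U *ℤ g₂ +ℤ V *ℤ g₁)
    expand = solve-∀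
    n≡ : n ≡ reduce t x *ℤ reduce t γ -ℤ (im x *ℤ im γ) *ℤ (t *ℤ t +ℤ + 1) -ℤ t *ℤ im (x *ᵍ γ)
    n≡ = trans (cong re xγ≡n) (expand (re x) (im x) (re γ) (im γ) t)

  module AboveSplitPrime (π : GI) (p : ℕ) (p-prime : Prime p) (π-prime : IsPrime π)
                         (ππ̄≡p : π *ᵍ conj π ≡ ι (+ p)) (π≉π̄ : ¬ Associated π (conj π)) where

    π̄ : GI
    π̄ = conj π

    π̄-prime : IsPrime π̄
    π̄-prime = IsPrime-conj π-prime

    ι[p^k]≡π^kπ̄^k : ∀ k → ι (+ (p ^ k)) ≡ π ^ᵍ k *ᵍ π̄ ^ᵍ k
    ι[p^k]≡π^kπ̄^k k = trans (ι-^ p k) (trans (cong (_^ᵍ k) (sym ππ̄≡p)) (^ᵍ-*-distrib π π̄ k))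

    p^k∣⇒π^k∣ : ∀ {k n} → + (p ^ k) ∣ℤ n → π ^ᵍ k ∣ ι n
    p^k∣⇒π^k∣ {k} p^k∣n = ∣-trans (divides (π̄ ^ᵍ k) (ι[p^k]≡π^kπ̄^k k)) (ι-∣ p^k∣n)

    p^k∣⇒π̄^k∣ : ∀ {k n} → + (p ^ k) ∣ℤ n → π̄ ^ᵍ k ∣ ι n
    p^k∣⇒π̄^k∣ {k} p^k∣n =
      ∣-trans (divides (π ^ᵍ k) (trans (ι[p^k]≡π^kπ̄^k k) (*ᵍ-comm (π ^ᵍ k) (π̄ ^ᵍ k)))) (ι-∣ p^k∣n)

    p∣⇒π∣ : ∀ {n} → + p ∣ℤ n → π ∣ ι n
    p∣⇒π∣ p∣n = ∣-trans (divides π̄ (sym ππ̄≡p)) (ι-∣ p∣n)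

    ≡[p^k]⇒≡[π^k] : ∀ {k a b} → + (p ^ k) ∣ℤ a -ℤ b → ι a ≡ ι b [mod π ^ᵍ k ]
    ≡[p^k]⇒≡[π^k] d = ∣-difference (p^k∣⇒π^k∣ d)

    ≡[p^k]⇒≡[π̄^k] : ∀ {k a b} → + (p ^ k) ∣ℤ a -ℤ b → ι a ≡ ι b [mod π̄ ^ᵍ k ]
    ≡[p^k]⇒≡[π̄^k] d = ∣-difference (p^k∣⇒π̄^k∣ d)

    N[π^k]≡p^k : ∀ k → re (π ^ᵍ k) *ℤ re (π ^ᵍ k) +ℤ im (π ^ᵍ k) *ℤ im (π ^ᵍ k) ≡ + (p ^ k)
    N[π^k]≡p^k k =
      trans (sym (re-*-conj (π ^ᵍ k))) (cong re (trans (cong (π ^ᵍ k *ᵍ_) (conj-^ π k)) (sym (ι[p^k]≡π^kπ̄^k k))))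

    -- π = π̄γ forces N(γ) = 1, so γ would be a unit and π, π̄ associated.
    π̄∤π : ¬ π̄ ∣ π
    π̄∤π π̄∣π@(divides γ π≡π̄γ) = π≉π̄ (∣⇒∣ᵍ π∣π̄ , ∣⇒∣ᵍ π̄∣π)
      where
      instance _ = prime⇒nonZero p-prime
      open ≡-Reasoning
      γγ̄≡1 : γ *ᵍ conj γ ≡ 1ᵍ
      γγ̄≡1 = *ᵍ-cancelʳ-ι (γ *ᵍ conj γ) 1ᵍ p (begin
        (γ *ᵍ conj γ) *ᵍ ι (+ p)         ≡⟨ cong ((γ *ᵍ conj γ) *ᵍ_) ππ̄≡p ⟨
        (γ *ᵍ conj γ) *ᵍ (π *ᵍ π̄)        ≡⟨ regroup γ (conj γ) π π̄ ⟩
        (π̄ *ᵍ γ) *ᵍ (π *ᵍ conj γ)        ≡⟨ cong (λ z → (π̄ *ᵍ γ) *ᵍ (z *ᵍ conj γ)) (conj-involutive π) ⟨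
        (π̄ *ᵍ γ) *ᵍ (conj π̄ *ᵍ conj γ)   ≡⟨ cong ((π̄ *ᵍ γ) *ᵍ_) (conj-* π̄ γ) ⟨
        (π̄ *ᵍ γ) *ᵍ conj (π̄ *ᵍ γ)        ≡⟨ cong (λ z → z *ᵍ conj z) π≡π̄γ ⟨
        π *ᵍ π̄                           ≡⟨ ππ̄≡p ⟩
        ι (+ p)                          ≡⟨ *ᵍ-identityˡ (ι (+ p)) ⟨
        1ᵍ *ᵍ ι (+ p)                    ∎)
        where
        regroup : ∀ a b c d → (a *ᵍ b) *ᵍ (c *ᵍ d) ≡ (d *ᵍ a) *ᵍ (c *ᵍ b)
        regroup = solve 4 (λ a b c d → (a :* b) :* (c :* d) := (d :* a) :* (c :* b)) refl
      π∣π̄ : π ∣ π̄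
      π∣π̄ = divides (conj γ) (sym (begin
        π *ᵍ conj γ              ≡⟨ cong (_*ᵍ conj γ) π≡π̄γ ⟩
        π̄ *ᵍ γ *ᵍ conj γ         ≡⟨ *ᵍ-assoc π̄ γ (conj γ) ⟩
        π̄ *ᵍ (γ *ᵍ conj γ)       ≡⟨ cong (π̄ *ᵍ_) γγ̄≡1 ⟩
        π̄ *ᵍ 1ᵍ                  ≡⟨ *ᵍ-comm π̄ 1ᵍ ⟩
        1ᵍ *ᵍ π̄                  ≡⟨ *ᵍ-identityˡ π̄ ⟩
        π̄                        ∎))

    π̄∤π^ : ∀ k → ¬ π̄ ∣ π ^ᵍ k
    π̄∤π^ zero = IsPrime.nonunit π̄-prime
    π̄∤π^ (suc k) = IsPrime.∤-* π̄-prime π̄∤π (π̄∤π^ k)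

    p∤im[π^suc] : ∀ k → ¬ (+ p ∣ℤ im (π ^ᵍ suc k))
    p∤im[π^suc] k p∣V = π̄∤π^ (suc k) (∣-trans π̄∣ι[p] (∣-re-im (π ^ᵍ suc k) p∣U p∣V))
      where
      π̄∣ι[p] : π̄ ∣ ι (+ p)
      π̄∣ι[p] = divides π (trans (sym ππ̄≡p) (*ᵍ-comm π π̄))
      p∣N : + p ∣ℤ re (π ^ᵍ suc k) *ℤ re (π ^ᵍ suc k) +ℤ im (π ^ᵍ suc k) *ℤ im (π ^ᵍ suc k)
      p∣N = subst (+ p ∣ℤ_) (trans (sym (ℤ.pos-* p (p ^ k))) (sym (N[π^k]≡p^k (suc k))))
              (ℤ∣.∣m⇒∣m*n (+ (p ^ k)) ℤ∣.∣-refl)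
      p∣U : + p ∣ℤ re (π ^ᵍ suc k)
      p∣U = p∣N∧p∣im⇒p∣re p-prime (π ^ᵍ suc k) p∣N p∣V

    coprime-im[π^k] : ∀ k → Coprime ∣ im (π ^ᵍ k) ∣ (p ^ k)
    coprime-im[π^k] zero = Coprimality.sym (1-coprimeTo _)
    coprime-im[π^k] (suc k) = coprime-^ (prime-∤⇒coprime p-prime (im (π ^ᵍ suc k)) (p∤im[π^suc] k)) (suc k)

    root[π^k] : ∀ k → RootOfMinusOne (π ^ᵍ k) (+ (p ^ k))
    root[π^k] k = rootOfMinusOne (π ^ᵍ k) (N[π^k]≡p^k k)
      (proj₂ (inverse-mod (im (π ^ᵍ k)) (p ^ k) (coprime-im[π^k] k))) p^k∣⇒π^k∣

    t[_] : ℕ → ℤ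
    t[ k ] = RootOfMinusOne.t (root[π^k] k)

    ≡ι-reduce-π^ : ∀ k α → α ≡ ι (reduce t[ k ] α) [mod π ^ᵍ k ]
    ≡ι-reduce-π^ k = ≡ι-reduce (RootOfMinusOne.t≡i (root[π^k] k))

    π^k∣ι⇒p^k∣ : ∀ k {n} → π ^ᵍ k ∣ ι n → + (p ^ k) ∣ℤ n
    π^k∣ι⇒p^k∣ k = ∣ι⇒∣ (root[π^k] k)

    ≡[π^k]⇒≡[p^k] : ∀ k {a b} → ι a ≡ ι b [mod π ^ᵍ k ] → + (p ^ k) ∣ℤ a -ℤ b
    ≡[π^k]⇒≡[p^k] k (∣-difference π^k∣a-b) = π^k∣ι⇒p^k∣ k π^k∣a-b

    coprime-reduce : ∀ k ξ → ¬ π ∣ ξ → Coprime ∣ reduce t[ k ] ξ ∣ (p ^ k)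
    coprime-reduce zero ξ _ = Coprimality.sym (1-coprimeTo _)
    coprime-reduce (suc r) ξ π∤ξ = coprime-^ (prime-∤⇒coprime p-prime (reduce t[ suc r ] ξ) p∤ξ̂) (suc r)
      where
      p∤ξ̂ : ¬ (+ p ∣ℤ reduce t[ suc r ] ξ)
      p∤ξ̂ p∣ξ̂ = π∤ξ (≡0⇒∣ (≡mod-trans (≡mod-∣ (∣-^-suc π r) (≡ι-reduce-π^ (suc r) ξ)) (∣⇒≡0 (p∣⇒π∣ p∣ξ̂))))

    inverse-mod-π^ : ∀ k ξ → ¬ π ∣ ξ → Σ ℤ λ c′ → ξ *ᵍ ι c′ ≡ 1ᵍ [mod π ^ᵍ k ]
    inverse-mod-π^ k ξ π∤ξ = c′ , (begin
      ξ *ᵍ ι c′        ≈⟨ *-congʳ-mod (ι c′) (≡ι-reduce-π^ k ξ) ⟩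
      ι c *ᵍ ι c′      ≡⟨ ι-* c c′ ⟨
      ι (c *ℤ c′)      ≈⟨ ≡[p^k]⇒≡[π^k] (proj₂ c⁻¹) ⟩
      1ᵍ               ∎)
      where
      open import Relation.Binary.Reasoning.Setoid (≡mod-setoid {π ^ᵍ k})
      c : ℤ
      c = reduce t[ k ] ξ
      c⁻¹ : Σ ℤ λ c′ → + (p ^ k) ∣ℤ c *ℤ c′ -ℤ + 1
      c⁻¹ = inverse-mod c (p ^ k) (coprime-reduce k ξ π∤ξ)
      c′ : ℤ
      c′ = proj₁ c⁻¹

    *-cancelʳ-mod : ∀ k {ξ δ δ′} → ¬ π ∣ ξ → δ *ᵍ ξ ≡ δ′ *ᵍ ξ [mod π ^ᵍ k ] → δ ≡ δ′ [mod π ^ᵍ k ]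
    *-cancelʳ-mod k {ξ} {δ} {δ′} π∤ξ δξ≡δ′ξ = begin
      δ                     ≡⟨ *ᵍ-identityʳ δ ⟨
      δ *ᵍ 1ᵍ               ≈⟨ *-congˡ-mod δ ξc′≡1 ⟨
      δ *ᵍ (ξ *ᵍ ι c′)      ≡⟨ *ᵍ-assoc δ ξ (ι c′) ⟨
      δ *ᵍ ξ *ᵍ ι c′        ≈⟨ *-congʳ-mod (ι c′) δξ≡δ′ξ ⟩
      δ′ *ᵍ ξ *ᵍ ι c′       ≡⟨ *ᵍ-assoc δ′ ξ (ι c′) ⟩
      δ′ *ᵍ (ξ *ᵍ ι c′)     ≈⟨ *-congˡ-mod δ′ ξc′≡1 ⟩
      δ′ *ᵍ 1ᵍ              ≡⟨ *ᵍ-identityʳ δ′ ⟩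
      δ′                    ∎
      where
      open import Relation.Binary.Reasoning.Setoid (≡mod-setoid {π ^ᵍ k})
      ξ⁻¹ : Σ ℤ λ c′ → ξ *ᵍ ι c′ ≡ 1ᵍ [mod π ^ᵍ k ]
      ξ⁻¹ = inverse-mod-π^ k ξ π∤ξ
      c′ : ℤ
      c′ = proj₁ ξ⁻¹
      ξc′≡1 : ξ *ᵍ ι c′ ≡ 1ᵍ [mod π ^ᵍ k ]
      ξc′≡1 = proj₂ ξ⁻¹

module Proportionality where

  open GaussianIntegers
  open ℤ[i]-Solver using (solve; _:+_; _:*_; _:-_; :-_; _:=_; con)
  open GaussianDivisibility
  open GaussianRationals
  open Valuation
  open LocalCongruence
  open IntegerModular
  open SplitPrime
  open import Data.Fin using (Fin) renaming (_<_ to _<ᶠ_)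
  open import Data.Fin.Properties using (<-cmp)
  open import Data.Nat as ℕ using (ℕ; zero; suc; _^_)
  open import Data.Nat.Coprimality using (Coprime; 1-coprimeTo)
  open import Data.Nat.Primality using (Prime)
  open import Data.Integer using (ℤ; +_; ∣_∣) renaming (_*_ to _*ℤ_; _-_ to _-ℤ_)
  open import Data.Integer.Divisibility.Signed using () renaming (_∣_ to _∣ℤ_)
  open import Data.Product using (Σ; _,_; _×_; proj₁; proj₂)
  open import Relation.Binary.Definitions using (tri<; tri≈; tri>)
  open import Relation.Binary.PropositionalEquality
  open import Relation.Nullary using (¬_)

  cross-≡-mod : ∀ m n (x y : Fin n → GI) → (∀ j k → j <ᶠ k → m ∣ᵍ ((x j *ᵍ y k) -ᵍ (x k *ᵍ y j)))
              → ∀ j k → x j *ᵍ y k ≡ x k *ᵍ y j [mod m ]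
  cross-≡-mod m n x y cross j k with <-cmp j k
  ... | tri< j<k _ _ = ∣-difference (∣ᵍ⇒∣ (cross j k j<k))
  ... | tri≈ _ refl _ = ≡⇒≡mod refl
  ... | tri> _ _ k<j = ≡mod-sym (∣-difference (∣ᵍ⇒∣ (cross k j k<j)))

  private
    module ℚ = ℚ[i]-Solver

    ⊗-into-sum : ∀ X Y H K → (X ⊗ (Y ⊗ H)) ≃q ((X ⊗ Y) ⊗ H ⊕ 0q ⊗ K)
    ⊗-into-sum = ℚ.solve 4 (λ X Y H K → X ℚ.:* (Y ℚ.:* H) ℚ.:= (X ℚ.:* Y) ℚ.:* H ℚ.:+ ℚ.con 0ᵍ ℚ.:* K) refl

    ⊗-by-one : ∀ X H → (X ⊗ H) ≃q ((X ⊗ 1q) ⊗ H)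
    ⊗-by-one = ℚ.solve 2 (λ X H → X ℚ.:* H ℚ.:= (X ℚ.:* ℚ.con 1ᵍ) ℚ.:* H) refl

    ⊗-into-sum′ : ∀ X Y Z H K → ((X ⊗ (Y ⊗ Z)) ⊗ H) ≃q (0q ⊗ K ⊕ (X ⊗ Z) ⊗ (Y ⊗ H))
    ⊗-into-sum′ = ℚ.solve 5 (λ X Y Z H K →
      (X ℚ.:* (Y ℚ.:* Z)) ℚ.:* H ℚ.:= ℚ.con 0ᵍ ℚ.:* K ℚ.:+ (X ℚ.:* Z) ℚ.:* (Y ℚ.:* H)) refl

  opaque
    unfolding _⊕_ _⊗_ ⊝_

    *q-into-sum : ∀ X Y H K → (X *q (Y *q H)) ≃q ((X *q Y) *q H +q 0q *q K)
    *q-into-sum = ⊗-into-sum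

    *q-by-one : ∀ X H → (X *q H) ≃q ((X *q 1q) *q H)
    *q-by-one = ⊗-by-one

    *q-into-sum′ : ∀ X Y Z H K → ((X *q (Y *q Z)) *q H) ≃q (0q *q K +q (X *q Z) *q (Y *q H))
    *q-into-sum′ = ⊗-into-sum′

  module Congruences (π : GI) (p : ℕ) (p-prime : Prime p) (π-prime : IsPrime π)
                     (ππ̄≡p : π *ᵍ conj π ≡ ι (+ p)) (π≉π̄ : ¬ Associated π (conj π)) where

    open AboveSplitPrime π p p-prime π-prime ππ̄≡p π≉π̄ public

    module _ {n : ℕ} (x y : Fin n → GI) where

      proportional : ∀ ρ j₀ → ¬ π ∣ x j₀ → ∀ j₁ → ¬ π ∣ y j₁ → (∀ j k → x j *ᵍ y k ≡ x k *ᵍ y j [mod π ^ᵍ ρ ])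
                   → Σ ℤ λ a → Coprime ∣ a ∣ p × (∀ j → y j ≡ ι a *ᵍ x j [mod π ^ᵍ ρ ])
      proportional zero _ _ _ _ _ = + 1 , 1-coprimeTo p , λ j → ∣-difference (1∣ _)
      proportional ρ@(suc r) j₀ π∤x₀ j₁ π∤y₁ cross = a , prime-∤⇒coprime p-prime a p∤a , y≡ax
        where
        x₀⁻¹ : Σ ℤ λ c′ → x j₀ *ᵍ ι c′ ≡ 1ᵍ [mod π ^ᵍ ρ ]
        x₀⁻¹ = inverse-mod-π^ ρ (x j₀) π∤x₀
        c′ ŷ₀ a : ℤ
        c′ = proj₁ x₀⁻¹
        ŷ₀ = reduce t[ ρ ] (y j₀)
        a = ŷ₀ *ℤ c′
        x₀c′≡1 : x j₀ *ᵍ ι c′ ≡ 1ᵍ [mod π ^ᵍ ρ ]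
        x₀c′≡1 = proj₂ x₀⁻¹
        y≡ax : ∀ k → y k ≡ ι a *ᵍ x k [mod π ^ᵍ ρ ]
        y≡ax k = begin
          y k                       ≡⟨ *ᵍ-identityˡ (y k) ⟨
          1ᵍ *ᵍ y k                 ≈⟨ *-congʳ-mod (y k) x₀c′≡1 ⟨
          x j₀ *ᵍ ι c′ *ᵍ y k       ≡⟨ swap (x j₀) (ι c′) (y k) ⟩
          ι c′ *ᵍ (x j₀ *ᵍ y k)     ≈⟨ *-congˡ-mod (ι c′) (cross j₀ k) ⟩
          ι c′ *ᵍ (x k *ᵍ y j₀)     ≈⟨ *-congˡ-mod (ι c′) (*-congˡ-mod (x k) (≡ι-reduce-π^ ρ (y j₀))) ⟩
          ι c′ *ᵍ (x k *ᵍ ι ŷ₀)     ≡⟨ rotate (ι c′) (x k) (ι ŷ₀) ⟩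
          ι ŷ₀ *ᵍ ι c′ *ᵍ x k       ≡⟨ cong (_*ᵍ x k) (ι-* ŷ₀ c′) ⟨
          ι a *ᵍ x k                ∎
          where
          open import Relation.Binary.Reasoning.Setoid (≡mod-setoid {π ^ᵍ ρ})
          swap : ∀ a b c → a *ᵍ b *ᵍ c ≡ b *ᵍ (a *ᵍ c)
          swap = solve 3 (λ a b c → a :* b :* c := b :* (a :* c)) refl
          rotate : ∀ a b c → a *ᵍ (b *ᵍ c) ≡ c *ᵍ a *ᵍ b
          rotate = solve 3 (λ a b c → a :* (b :* c) := c :* a :* b) refl
        p∤a : ¬ (+ p ∣ℤ a)
        p∤a p∣a = π∤y₁ (≡0⇒∣ (≡mod-trans (≡mod-∣ (∣-^-suc π r) (y≡ax j₁)) (∣⇒≡0 (∣-*ʳ (x j₁) (p∣⇒π∣ p∣a)))))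

      proportional-unique : ∀ ρ j₀ → ¬ π ∣ x j₀ → ∀ a₁ a₂
                          → (∀ j → y j ≡ ι a₁ *ᵍ x j [mod π ^ᵍ ρ ]) → (∀ j → y j ≡ ι a₂ *ᵍ x j [mod π ^ᵍ ρ ])
                          → + (p ^ ρ) ∣ℤ a₁ -ℤ a₂
      proportional-unique ρ j₀ π∤x₀ a₁ a₂ y≡a₁x y≡a₂x =
        ≡[π^k]⇒≡[p^k] ρ (*-cancelʳ-mod ρ {x j₀} {ι a₁} {ι a₂} π∤x₀ (≡mod-trans (≡mod-sym (y≡a₁x j₀)) (y≡a₂x j₀)))

    conj-≡[π^k] : ∀ {k α β} → α ≡ β [mod π ^ᵍ k ] → conj α ≡ conj β [mod π̄ ^ᵍ k ]
    conj-≡[π^k] {k} α≡β = subst (λ m → _ ≡ _ [mod m ]) (conj-^ π k) (≡mod-conj α≡β)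

    module _ (ρ : ℕ) (a : ℤ) where

      b : ℤ
      b = a *ℤ t[ ρ ]

      b≡ai : ι b ≡ ι a *ᵍ iᵍ [mod π ^ᵍ ρ ]
      b≡ai = begin
        ι b               ≡⟨ ι-* a t[ ρ ] ⟩
        ι a *ᵍ ι t[ ρ ]   ≈⟨ *-congˡ-mod (ι a) (RootOfMinusOne.t≡i (root[π^k] ρ)) ⟩
        ι a *ᵍ iᵍ         ∎
        where open import Relation.Binary.Reasoning.Setoid (≡mod-setoid {π ^ᵍ ρ})

      b-unique : ∀ b₁ → ι b₁ ≡ ι a *ᵍ iᵍ [mod π ^ᵍ ρ ] → + (p ^ ρ) ∣ℤ b₁ -ℤ b
      b-unique b₁ b₁≡ai = ≡[π^k]⇒≡[p^k] ρ (≡mod-trans b₁≡ai (≡mod-sym b≡ai))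

      2a≡a-bi : ι (+ 2) *ᵍ ι a ≡ ι a -ᵍ ι b *ᵍ iᵍ [mod π ^ᵍ ρ ]
      2a≡a-bi = ≡mod-sym (begin
        ι a -ᵍ ι b *ᵍ iᵍ          ≈⟨ +-congˡ-mod (ι a) (-‿cong-mod (*-congʳ-mod iᵍ b≡ai)) ⟩
        ι a -ᵍ ι a *ᵍ iᵍ *ᵍ iᵍ    ≡⟨ double (ι a) ⟩
        ι (+ 2) *ᵍ ι a            ∎)
        where
        open import Relation.Binary.Reasoning.Setoid (≡mod-setoid {π ^ᵍ ρ})
        double : ∀ a → a -ᵍ a *ᵍ iᵍ *ᵍ iᵍ ≡ ι (+ 2) *ᵍ a
        double = solve 1 (λ a → a :- a :* con iᵍ :* con iᵍ := con (ι (+ 2)) :* a) refl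

      a-bi≡0[π̄^ρ] : ι a -ᵍ ι b *ᵍ iᵍ ≡ 0ᵍ [mod π̄ ^ᵍ ρ ]
      a-bi≡0[π̄^ρ] = begin
        ι a -ᵍ ι b *ᵍ iᵍ                  ≈⟨ +-congˡ-mod (ι a) (-‿cong-mod (*-congʳ-mod iᵍ b≡a·conj[i])) ⟩
        ι a -ᵍ ι a *ᵍ conj iᵍ *ᵍ iᵍ       ≡⟨ cancel (ι a) ⟩
        0ᵍ                                ∎
        where
        open import Relation.Binary.Reasoning.Setoid (≡mod-setoid {π̄ ^ᵍ ρ})
        b≡a·conj[i] : ι b ≡ ι a *ᵍ conj iᵍ [mod π̄ ^ᵍ ρ ]
        b≡a·conj[i] = subst (λ β → ι b ≡ β [mod π̄ ^ᵍ ρ ]) (conj-* (ι a) iᵍ) (conj-≡[π^k] b≡ai)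
        cancel : ∀ a → a -ᵍ a *ᵍ conj iᵍ *ᵍ iᵍ ≡ 0ᵍ
        cancel = solve 1 (λ a → a :- a :* con (conj iᵍ) :* con iᵍ := con 0ᵍ) refl

      a′-b′i≡0[π^ρ] : ∀ a′ b′ → + (p ^ ρ) ∣ℤ a *ℤ a′ -ℤ + 1 → + (p ^ ρ) ∣ℤ b *ℤ b′ -ℤ + 1
                    → ι a′ -ᵍ ι b′ *ᵍ iᵍ ≡ 0ᵍ [mod π ^ᵍ ρ ]
      a′-b′i≡0[π^ρ] a′ b′ aa′≡1 bb′≡1 = begin
        ι a′ -ᵍ ι b′ *ᵍ iᵍ                             ≡⟨ cong (_-ᵍ ι b′ *ᵍ iᵍ) (*ᵍ-identityʳ (ι a′)) ⟨
        ι a′ *ᵍ 1ᵍ -ᵍ ι b′ *ᵍ iᵍ                       ≈⟨ +-congʳ-mod (-ᵍ (ι b′ *ᵍ iᵍ)) (*-congˡ-mod (ι a′) (≡mod-sym (ι≡ b b′ bb′≡1))) ⟩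
        ι a′ *ᵍ (ι b *ᵍ ι b′) -ᵍ ι b′ *ᵍ iᵍ            ≈⟨ +-congʳ-mod (-ᵍ (ι b′ *ᵍ iᵍ)) (*-congˡ-mod (ι a′) (*-congʳ-mod (ι b′) b≡ai)) ⟩
        ι a′ *ᵍ (ι a *ᵍ iᵍ *ᵍ ι b′) -ᵍ ι b′ *ᵍ iᵍ      ≡⟨ regroup (ι a′) (ι a) (ι b′) ⟩
        (ι a *ᵍ ι a′) *ᵍ (ι b′ *ᵍ iᵍ) -ᵍ ι b′ *ᵍ iᵍ    ≈⟨ +-congʳ-mod (-ᵍ (ι b′ *ᵍ iᵍ)) (*-congʳ-mod (ι b′ *ᵍ iᵍ) (ι≡ a a′ aa′≡1)) ⟩
        1ᵍ *ᵍ (ι b′ *ᵍ iᵍ) -ᵍ ι b′ *ᵍ iᵍ               ≡⟨ cancel (ι b′ *ᵍ iᵍ) ⟩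
        0ᵍ                                             ∎
        where
        open import Relation.Binary.Reasoning.Setoid (≡mod-setoid {π ^ᵍ ρ})
        ι≡ : ∀ c c′ → + (p ^ ρ) ∣ℤ c *ℤ c′ -ℤ + 1 → ι c *ᵍ ι c′ ≡ 1ᵍ [mod π ^ᵍ ρ ]
        ι≡ c c′ cc′≡1 = subst (λ γ → γ ≡ 1ᵍ [mod π ^ᵍ ρ ]) (ι-* c c′) (≡[p^k]⇒≡[π^k] {ρ} {c *ℤ c′} {+ 1} cc′≡1)
        regroup : ∀ a′ a b′ → a′ *ᵍ (a *ᵍ iᵍ *ᵍ b′) -ᵍ b′ *ᵍ iᵍ ≡ (a *ᵍ a′) *ᵍ (b′ *ᵍ iᵍ) -ᵍ b′ *ᵍ iᵍ
        regroup = solve 3 (λ a′ a b′ → a′ :* (a :* con iᵍ :* b′) :- b′ :* con iᵍ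
                                    := (a :* a′) :* (b′ :* con iᵍ) :- b′ :* con iᵍ) refl
        cancel : ∀ z → 1ᵍ *ᵍ z -ᵍ z ≡ 0ᵍ
        cancel = solve 1 (λ z → con 1ᵍ :* z :- z := con 0ᵍ) refl

      2a′≡a′-b′i[π̄^ρ] : ∀ a′ b′ → + (p ^ ρ) ∣ℤ a *ℤ a′ -ℤ + 1 → + (p ^ ρ) ∣ℤ b *ℤ b′ -ℤ + 1
                      → ι (+ 2) *ᵍ ι a′ ≡ ι a′ -ᵍ ι b′ *ᵍ iᵍ [mod π̄ ^ᵍ ρ ]
      2a′≡a′-b′i[π̄^ρ] a′ b′ aa′≡1 bb′≡1 = begin
        ι (+ 2) *ᵍ ι a′                                ≡⟨ split (ι a′) (ι b′) ⟩
        C′ +ᵍ (ι a′ -ᵍ ι b′ *ᵍ conj iᵍ)               ≡⟨ cong (C′ +ᵍ_) conj[C′]≡ ⟨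
        C′ +ᵍ conj C′                                  ≈⟨ +-congˡ-mod C′ (conj-≡[π^k] (a′-b′i≡0[π^ρ] a′ b′ aa′≡1 bb′≡1)) ⟩
        C′ +ᵍ 0ᵍ                                       ≡⟨ +ᵍ-identityʳ C′ ⟩
        C′                                             ∎
        where
        open import Relation.Binary.Reasoning.Setoid (≡mod-setoid {π̄ ^ᵍ ρ})
        C′ : GI
        C′ = ι a′ -ᵍ ι b′ *ᵍ iᵍ
        conj[C′]≡ : conj C′ ≡ ι a′ -ᵍ ι b′ *ᵍ conj iᵍ
        conj[C′]≡ = trans (conj-sub (ι a′) (ι b′ *ᵍ iᵍ)) (cong (λ z → ι a′ -ᵍ z) (conj-* (ι b′) iᵍ))
        split : ∀ a b → ι (+ 2) *ᵍ a ≡ (a -ᵍ b *ᵍ iᵍ) +ᵍ (a -ᵍ b *ᵍ conj iᵍ)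
        split = solve 2 (λ a b → con (ι (+ 2)) :* a := (a :- b :* con iᵍ) :+ (a :- b :* con (conj iᵍ))) refl
        +ᵍ-identityʳ : ∀ z → z +ᵍ 0ᵍ ≡ z
        +ᵍ-identityʳ = solve 1 (λ z → z :+ con 0ᵍ := z) refl

    module HermitianCongruence (ρ n : ℕ) (A : Fin n → Fin n → ℚi)
      (A-integral[π] : ∀ j k → Integral π (A j k)) (A-integral[π̄] : ∀ j k → Integral π̄ (A j k))
      (x y : Fin n → GI) (a : ℤ) (y≡ax : ∀ j → y j ≡ ι a *ᵍ x j [mod π ^ᵍ ρ ])
      (a′ b′ : ℤ) (aa′≡1 : + (p ^ ρ) ∣ℤ a *ℤ a′ -ℤ + 1) (bb′≡1 : + (p ^ ρ) ∣ℤ b ρ a *ℤ b′ -ℤ + 1) where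

      private
        two H[x,x] H[x,y] H[y,y] : ℚi
        two = ιq (ι (+ 2))
        H[x,x] = herm n x A x
        H[x,y] = herm n x A y
        H[y,y] = herm n y A y
        C C′ : GI
        C = ι a -ᵍ ι (b ρ a) *ᵍ iᵍ
        C′ = ι a′ -ᵍ ι b′ *ᵍ iᵍ
        C′≡0[π^ρ] : C′ ≡ 0ᵍ [mod π ^ᵍ ρ ]
        C′≡0[π^ρ] = a′-b′i≡0[π^ρ] ρ a a′ b′ aa′≡1 bb′≡1

      -- Modulo π^ρ: y ≡ a x, b ≡ a i and C′ ≡ 0, so both sides reduce to 2a x*Ax.
      congruence[π^ρ] : two *q H[x,y] ≡q ιq C *q H[x,x] +q ιq C′ *q H[y,y] [mod π ^ ρ ]
      congruence[π^ρ] = begin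
        two *q H[x,y]                                   ≈⟨ *q-cong-mod π-prime two two H[x,y] (ιq (ι a) *q H[x,x])
                                                             (integral-herm x y) (Integral-ιq π-prime (ι (+ 2))) (≃q⇒≡q π-prime refl)
                                                             (herm-congʳ π-prime n A A-integral[π] x y (ι a) x y≡ax) ⟩
        two *q (ιq (ι a) *q H[x,x])                     ≈⟨ ≃q⇒≡q π-prime (*q-into-sum two (ιq (ι a)) H[x,x] H[y,y]) ⟩
        ιq (ι (+ 2) *ᵍ ι a) *q H[x,x] +q 0q *q H[y,y]   ≈⟨ +q-cong-mod π-prime (ιq (ι (+ 2) *ᵍ ι a) *q H[x,x]) (ιq C *q H[x,x]) (0q *q H[y,y]) (ιq C′ *q H[y,y])
                                                             (*q-cong-mod π-prime (ιq (ι (+ 2) *ᵍ ι a)) (ιq C) H[x,x] H[x,x]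
                                                               (integral-herm x x) (Integral-ιq π-prime C)
                                                               (ιq-cong-mod π-prime (2a≡a-bi ρ a)) (≃q⇒≡q π-prime refl))
                                                             (*q-cong-mod π-prime 0q (ιq C′) H[y,y] H[y,y]
                                                               (integral-herm y y) (Integral-ιq π-prime C′)
                                                               (ιq-cong-mod π-prime (≡mod-sym C′≡0[π^ρ])) (≃q⇒≡q π-prime refl)) ⟩
        ιq C *q H[x,x] +q ιq C′ *q H[y,y]               ∎
        where
        open import Relation.Binary.Reasoning.Setoid (≡q-setoid π-prime {ρ})
        integral-herm : ∀ u w → Integral π (herm n u A w)
        integral-herm u w = Integral-herm π-prime n u A w A-integral[π]

      -- Modulo π̄^ρ: ȳ ≡ a x̄, a - bi ≡ 0 and a′ - b′i ≡ 2a′, so the right side reduces to 2aa′ x*Ay.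
      congruence[π̄^ρ] : two *q H[x,y] ≡q ιq C *q H[x,x] +q ιq C′ *q H[y,y] [mod π̄ ^ ρ ]
      congruence[π̄^ρ] = begin
        two *q H[x,y]                                  ≈⟨ ≃q⇒≡q π̄-prime (*q-by-one two H[x,y]) ⟩
        (two *q 1q) *q H[x,y]                          ≈⟨ *q-cong-mod π̄-prime (two *q 1q) (two *q aa′) H[x,y] H[x,y]
                                                            (integral x y) (Integral-ιq π̄-prime (ι (+ 2) *ᵍ (ι a *ᵍ ι a′)))
                                                            (ιq-cong-mod π̄-prime (*-congˡ-mod (ι (+ 2)) (≡mod-sym aa′≡1[π̄^ρ])))
                                                            (≃q⇒≡q π̄-prime refl) ⟩
        (two *q aa′) *q H[x,y]                         ≈⟨ ≃q⇒≡q π̄-prime (*q-into-sum′ two (ιq (ι a)) (ιq (ι a′)) H[x,y] H[x,x]) ⟩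
        0q *q H[x,x] +q (two *q ιq (ι a′)) *q a·H[x,y] ≈⟨ +q-cong-mod π̄-prime (0q *q H[x,x]) (ιq C *q H[x,x])
                                                            ((two *q ιq (ι a′)) *q a·H[x,y]) (ιq C′ *q H[y,y])
                                                            (*q-cong-mod π̄-prime 0q (ιq C) H[x,x] H[x,x]
                                                              (integral x x) (Integral-ιq π̄-prime C)
                                                              (ιq-cong-mod π̄-prime (≡mod-sym (a-bi≡0[π̄^ρ] ρ a))) (≃q⇒≡q π̄-prime refl))
                                                            (*q-cong-mod π̄-prime (two *q ιq (ι a′)) (ιq C′) a·H[x,y] H[y,y]
                                                              (Val≥-* π̄-prime (ιq (ι a)) H[x,y] (Integral-ιq π̄-prime (ι a)) (integral x y))
                                                              (Integral-ιq π̄-prime C′)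
                                                              (ιq-cong-mod π̄-prime (2a′≡a′-b′i[π̄^ρ] ρ a a′ b′ aa′≡1 bb′≡1))
                                                              (≡q-sym π̄-prime H[y,y]≡a·H[x,y])) ⟩
        ιq C *q H[x,x] +q ιq C′ *q H[y,y]              ∎
        where
        open import Relation.Binary.Reasoning.Setoid (≡q-setoid π̄-prime {ρ})
        integral : ∀ u w → Integral π̄ (herm n u A w)
        integral u w = Integral-herm π̄-prime n u A w A-integral[π̄]
        aa′ a·H[x,y] : ℚi
        aa′ = ιq (ι a) *q ιq (ι a′)
        a·H[x,y] = ιq (ι a) *q H[x,y]
        aa′≡1[π̄^ρ] : ι a *ᵍ ι a′ ≡ 1ᵍ [mod π̄ ^ᵍ ρ ]
        aa′≡1[π̄^ρ] = subst (λ γ → γ ≡ 1ᵍ [mod π̄ ^ᵍ ρ ]) (ι-* a a′) (≡[p^k]⇒≡[π̄^k] {ρ} {a *ℤ a′} {+ 1} aa′≡1)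
        ȳ≡a·x̄ : ∀ j → conj (y j) ≡ ι a *ᵍ conj (x j) [mod π̄ ^ᵍ ρ ]
        ȳ≡a·x̄ j = subst (λ β → conj (y j) ≡ β [mod π̄ ^ᵍ ρ ]) (conj-* (ι a) (x j)) (conj-≡[π^k] (y≡ax j))
        H[y,y]≡a·H[x,y] : H[y,y] ≡q a·H[x,y] [mod π̄ ^ ρ ]
        H[y,y]≡a·H[x,y] = herm-congˡ π̄-prime n A A-integral[π̄] y y (ι a) x ȳ≡a·x̄

open GaussianDivisibility using (_≡_[mod_]; IsPrimeᵍ⇒IsPrime; ∣⇒∣ᵍ; ≡mod⇒∣ᵍ; ∣ᵍ⇒≡mod; ≡0⇒∣)
open Valuation using (Integral; Val≥⇒vGe; vGe⇒Val≥; Integral-selfadjoint-conj)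
open LocalCongruence using (Val≥-difference)
open Proportionality using (cross-≡-mod; module Congruences)
open import Data.Nat using (ℕ; _^_)
open import Data.Nat.Primality using (Prime)
open import Data.Nat.Coprimality using (Coprime)
open import Data.Integer using (ℤ; +_; ∣_∣; _*_; _-_)
open import Data.Integer.Divisibility using (_∣_)
open import Data.Integer.Divisibility.Signed using (∣ᵤ⇒∣; ∣⇒∣ᵤ)
open import Data.Fin using (Fin) renaming (_<_ to _<ᶠ_)
open import Data.Product using (Σ; _×_; _,_; proj₁; proj₂)
open import Function using (_∘_)
open import Relation.Nullary using (¬_)
open import Relation.Binary.PropositionalEquality using (_≡_)

lemma1 : (π : GI) (p : ℕ) → Prime p → IsPrimeᵍ π → π *ᵍ conj π ≡ ι (+ p)
         → ¬ Associated π (conj π)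
         → (ρ n : ℕ) (A : Fin n → Fin n → ℚi)
         → (∀ j k → A k j ≃q conjq (A j k))
         → (∀ j k → vGe π 0 (A j k))
         → (x y : Fin n → GI)
         → Σ (Fin n) (λ j → ¬ (π ∣ᵍ x j))
         → Σ (Fin n) (λ j → ¬ (π ∣ᵍ y j))
         → (∀ j k → j <ᶠ k → (π ^ᵍ ρ) ∣ᵍ ((x j *ᵍ y k) -ᵍ (x k *ᵍ y j)))
         → (Σ ℤ (λ a → Coprime ∣ a ∣ p × (∀ j → (π ^ᵍ ρ) ∣ᵍ (y j -ᵍ ι a *ᵍ x j))))
           × (∀ a₁ a₂ → (∀ j → (π ^ᵍ ρ) ∣ᵍ (y j -ᵍ ι a₁ *ᵍ x j))
                      → (∀ j → (π ^ᵍ ρ) ∣ᵍ (y j -ᵍ ι a₂ *ᵍ x j))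
                      → (+ (p ^ ρ)) ∣ (a₁ - a₂))
           × (∀ a → Coprime ∣ a ∣ p → (∀ j → (π ^ᵍ ρ) ∣ᵍ (y j -ᵍ ι a *ᵍ x j))
              → Σ ℤ (λ b → ((π ^ᵍ ρ) ∣ᵍ (ι b -ᵍ ι a *ᵍ iᵍ))
                 × (∀ b₁ → (π ^ᵍ ρ) ∣ᵍ (ι b₁ -ᵍ ι a *ᵍ iᵍ) → (+ (p ^ ρ)) ∣ (b₁ - b))
                 × ((conj π ^ᵍ ρ) ∣ᵍ (ι a -ᵍ ι b *ᵍ iᵍ))
                 × (∀ a' b' → (+ (p ^ ρ)) ∣ (a * a' - + 1) → (+ (p ^ ρ)) ∣ (b * b' - + 1)
                    → CongModPP π ρ
                        (ιq (ι (+ 2)) *q herm n x A y)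
                        ((ιq (ι a -ᵍ ι b *ᵍ iᵍ) *q herm n x A x)
                          +q (ιq (ι a' -ᵍ ι b' *ᵍ iᵍ) *q herm n y A y))
                      × ((π ^ᵍ ρ) ∣ᵍ (ι a' -ᵍ ι b' *ᵍ iᵍ)))))
lemma1 π p p-prime π-prime ππ̄≡p π≉π̄ ρ n A A-selfadjoint A-integral x y (j₀ , π∤x₀) (j₁ , π∤y₁) cross =
  (a , a-coprime , λ j → ≡mod⇒∣ᵍ (y≡ax j)) ,
  (λ a₁ a₂ y≡a₁x y≡a₂x → ∣⇒∣ᵤ (proportional-unique x y ρ j₀ (π∤x₀ ∘ ∣⇒∣ᵍ) a₁ a₂
                                  (λ j → ∣ᵍ⇒≡mod (y≡a₁x j)) (λ j → ∣ᵍ⇒≡mod (y≡a₂x j)))) ,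
  λ a _ y≡ax → b ρ a , ≡mod⇒∣ᵍ (b≡ai ρ a) , (λ b₁ b₁≡ai → ∣⇒∣ᵤ (b-unique ρ a b₁ (∣ᵍ⇒≡mod b₁≡ai))) ,
    ∣⇒∣ᵍ (≡0⇒∣ (a-bi≡0[π̄^ρ] ρ a)) ,
    λ a′ b′ aa′≡1 bb′≡1 →
      let open HermitianCongruence ρ n A A-integral[π] A-integral[π̄] x y a (λ j → ∣ᵍ⇒≡mod (y≡ax j))
                                   a′ b′ (∣ᵤ⇒∣ aa′≡1) (∣ᵤ⇒∣ bb′≡1)
      in (Val≥⇒vGe (Val≥-difference congruence[π^ρ]) , Val≥⇒vGe (Val≥-difference congruence[π̄^ρ])) ,
         ∣⇒∣ᵍ (≡0⇒∣ (a′-b′i≡0[π^ρ] ρ a a′ b′ (∣ᵤ⇒∣ aa′≡1) (∣ᵤ⇒∣ bb′≡1)))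
  where
  open Congruences π p p-prime (IsPrimeᵍ⇒IsPrime π-prime) ππ̄≡p π≉π̄
  A-integral[π] : ∀ j k → Integral π (A j k)
  A-integral[π] j k = vGe⇒Val≥ (A-integral j k)
  A-integral[π̄] : ∀ j k → Integral (conj π) (A j k)
  A-integral[π̄] = Integral-selfadjoint-conj π̄-prime A A-selfadjoint A-integral[π]
  proportionality : Σ ℤ λ a → Coprime ∣ a ∣ p × (∀ j → y j ≡ ι a *ᵍ x j [mod π ^ᵍ ρ ])
  proportionality = proportional x y ρ j₀ (π∤x₀ ∘ ∣⇒∣ᵍ) j₁ (π∤y₁ ∘ ∣⇒∣ᵍ) (cross-≡-mod _ n x y cross)
  a : ℤ
  a = proj₁ proportionality
  a-coprime : Coprime ∣ a ∣ p
  a-coprime = proj₁ (proj₂ proportionality)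
  y≡ax : ∀ j → y j ≡ ι a *ᵍ x j [mod π ^ᵍ ρ ]
  y≡ax = proj₂ (proj₂ proportionality)
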